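{- Let $q$ be a prime power, $k\ge1$, $n=2k+1$, and let $\alpha$ be a primitive element of $\mathbb{F}_{q^n}$ (with $\mathbb{F}_{q^n}$ identified with $\mathbb{F}_q^n$ as an $\mathbb{F}_q$-vector space). Suppose there is a sequence $X_1,Y_1,X_2,Y_2,\ldots,X_t,Y_t$ of subspaces of $\mathbb{F}_q^{n}$ such that: (P.1) each $X_i$ ($1\le i\le t$) has dimension $k$; (P.2) each $Y_i$ ($1\le i\le t$) has dimension $k+1$; (P.3) the $2t$ subspaces of the sequence lie in $2t$ pairwise different equivalence classes of the relations $E_k$ and $E_{k+1}$; (P.4) $X_i\subset Y_i$ for $1\le i\le t$; (P.5) $X_{i+1}\subset Y_i$ for $1\le i\le t-1$; (P.6) there is an integer $\ell$ with $\alpha^\ell X_1\subset Y_t$ and $\gcd\!\left(\ell,\frac{q^{2k+1}-1}{q-1}\right)=1$. Then the middle levels graph of $\mathcal{P}_q(2k+1)$ contains a cycle of length $2t\cdot\frac{q^{2k+1}-1}{q-1}$.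
   Context: $\mathcal{P}_q(n)$ is the graph on all subspaces of $\mathbb{F}_q^n$ where $X,Y$ are adjacent iff one contains the other and their dimensions differ by one. The middle levels graph of $\mathcal{P}_q(2k+1)$ is the subgraph induced by the $k$- and $(k+1)$-dimensional subspaces. For a subspace $X$ and nonzero $\beta\in\mathbb{F}_{q^n}$, $\beta X=\{\beta x: x\in X\}$ (again a subspace of the same dimension). For $0\le r\le n$, $E_r$ is the relation on the set of $r$-dimensional subspaces of $\mathbb{F}_q^n$ given by $(X,Y)\in E_r$ iff $Y=\alpha^jX$ for some integer $j$; it is an equivalence relation. -}

module Defs where

open import Level using (0ℓ)
open import Data.Nat as ℕ using (ℕ; zero; suc; _≤_; _<_; _∸_; _^_)
open import Data.Nat.DivMod using (_/_)
open import Data.Nat.Primality using (Prime)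
open import Data.Integer as ℤ using (ℤ; +_; -[1+_])
open import Data.Fin using (Fin)
open import Data.Product using (Σ; ∃; _×_; _,_)
open import Data.Sum using (_⊎_)
open import Relation.Nullary using (¬_)
open import Relation.Binary.PropositionalEquality using (_≡_)
open import Algebra.Structures using (IsCommutativeRing)
open import Function.Bundles using (_↔_; _⇔_)

-- A field, with propositional equality as its equality.
-- The inverse is total; only its value on nonzero elements is constrained.
record Field : Set₁ where
  infixl 7 _*_
  infixl 6 _+_
  field
    Carrier : Set
    _+_ _*_ : Carrier → Carrier → Carrier
    -_ : Carrier → Carrier
    0# 1# : Carrier
    _⁻¹ : Carrier → Carrier
    isCommutativeRing : IsCommutativeRing _≡_ _+_ _*_ -_ 0# 1#
    0≢1 : ¬ (0# ≡ 1#)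
    inverseʳ : ∀ x → ¬ (x ≡ 0#) → x * (x ⁻¹) ≡ 1#

  _^ᴺ_ : Carrier → ℕ → Carrier
  x ^ᴺ zero = 1#
  x ^ᴺ suc m = x * (x ^ᴺ m)

  _^ᶻ_ : Carrier → ℤ → Carrier
  x ^ᶻ (+ m) = x ^ᴺ m
  x ^ᶻ -[1+ m ] = (x ⁻¹) ^ᴺ suc m

HasSize : Field → ℕ → Set
HasSize F m = Field.Carrier F ↔ Fin m

IsPrimePower : ℕ → Set
IsPrimePower q = Σ ℕ λ p → Σ ℕ λ e → Prime p × q ≡ p ^ suc e

-- ι : Fq → K is an (injective) field embedding, making K an Fq-vector space
record Embedding (Fq K : Field) : Set where
  module Fq = Field Fq
  module K = Field K
  field
    ι : Fq.Carrier → K.Carrier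
    ι-+ : ∀ a b → ι (a Fq.+ b) ≡ ι a K.+ ι b
    ι-* : ∀ a b → ι (a Fq.* b) ≡ ι a K.* ι b
    ι-1 : ι Fq.1# ≡ K.1#
    ι-inj : ∀ a b → ι a ≡ ι b → a ≡ b

Primitive : (K : Field) → Field.Carrier K → Set
Primitive K α = ∀ x → ¬ (x ≡ 0#) → Σ ℕ λ m → x ≡ α ^ᴺ m
  where open Field K

module VectorSpace {Fq K : Field} (E : Embedding Fq K) where
  open Embedding E
  open Field K

  lincomb : ∀ d → (Fin d → Fq.Carrier) → (Fin d → Carrier) → Carrier
  lincomb zero c b = 0#
  lincomb (suc d) c b = ι (c Fin.zero) * b Fin.zero
                        + lincomb d (λ i → c (Fin.suc i)) (λ i → b (Fin.suc i))
    where import Data.Fin as Fin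

  LinIndep : ∀ d → (Fin d → Carrier) → Set
  LinIndep d b = ∀ (c : Fin d → Fq.Carrier) → lincomb d c b ≡ 0# → ∀ i → c i ≡ Fq.0#

  InSpan : ∀ d → (Fin d → Carrier) → Carrier → Set
  InSpan d b x = Σ (Fin d → Fq.Carrier) λ c → x ≡ lincomb d c b

  -- (candidate) subspaces are represented by their membership predicate
  Sub : Set₁
  Sub = Carrier → Set

  HasDim : Sub → ℕ → Set
  HasDim X d = Σ (Fin d → Carrier) λ b → LinIndep d b × (∀ x → X x ⇔ InSpan d b x)

  _⊆_ : Sub → Sub → Set
  X ⊆ Y = ∀ x → X x → Y x

  _≐_ : Sub → Sub → Set
  X ≐ Y = X ⊆ Y × Y ⊆ X

  _·_ : Carrier → Sub → Sub
  (β · X) y = Σ Carrier λ x → X x × y ≡ β * x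

  -- the relation E_r (restricted to r-dimensional subspaces by the caller)
  Erel : Carrier → Sub → Sub → Set
  Erel α X Y = Σ ℤ λ j → Y ≐ ((α ^ᶻ j) · X)

  Adjacent : Sub → Sub → Set
  Adjacent X Y =
      (X ⊆ Y × Σ ℕ λ d → HasDim X d × HasDim Y (suc d))
    ⊎ (Y ⊆ X × Σ ℕ λ d → HasDim Y d × HasDim X (suc d))

  MiddleVertex : ℕ → Sub → Set
  MiddleVertex k X = HasDim X k ⊎ HasDim X (suc k)

  HasMiddleCycle : ℕ → ℕ → Set₁
  HasMiddleCycle k L = Σ (ℕ → Sub) λ v →
      3 ≤ L
    × (∀ i → i < L → MiddleVertex k (v i))
    × (∀ i j → i < j → j < L → ¬ (v i ≐ v j))
    × (∀ i → suc i < L → Adjacent (v i) (v (suc i)))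
    × Adjacent (v (L ∸ 1)) (v 0)

-- (q^n - 1)/(q - 1)  (q ≥ 2 in all uses)
gauss : ℕ → ℕ → ℕ
gauss (suc (suc m)) n = ((suc (suc m)) ^ n ∸ 1) / suc m
gauss _ _ = 0

module Submission where

-- Let n = 2k+1, N = (q^n - 1)/(q - 1), and let L be a natural exponent with α^L = α^ℓ.
-- The cycle visits, for laps j = 0, …, N - 1, the subspaces
--     α^(jL) X₁, α^(jL) Y₁, α^(jL) X₂, …, α^(jL) X_t, α^(jL) Y_t.
-- Consecutive ones are adjacent by (P.4) and (P.5), and by (P.6) from the end of a lap to
-- the start of the next; the walk closes because α^(NL) is a nonzero element of Fq, which
-- fixes every subspace.  Vertices of different dimensions, or of different indices i, are
-- distinct by (P.3).  For equal index and laps j < j' < N we use the stabiliser lemma: a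
-- subspace of dimension k or k+1 mapped into itself by α^e satisfies N ∣ e.  (Indeed, by
-- Bézout α^s with s = gcd(e, N) also stabilises it; the order of α^s divides q^d - 1 by
-- counting orbits on the nonzero vectors, and gcd(q^d - 1, q^n - 1) = q - 1 forces s = N.)
-- As gcd(ℓ, N) = 1 this would give N ∣ j' - j, which is impossible.

open import Defs
open import Data.Nat using (ℕ; suc; _≤_; _<_)
import Data.Nat as ℕ
open import Data.Nat.GCD using (gcd)
open import Data.Integer using (ℤ; ∣_∣)
open import Data.Fin using (Fin)
open import Data.Product using (Σ; _×_)
open import Relation.Nullary using (¬_)
open import Relation.Binary.PropositionalEquality using (_≡_)
open import Function.Bundles using (_↔_)

module Counting where

  open import Data.Nat as ℕ using (ℕ; zero; suc; _+_; _∸_; _≤_; _<_; z≤n)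
  open import Data.Nat.Properties hiding (_≟_; suc-injective)
  open import Data.Fin as F using (Fin; toℕ)
  open import Data.Fin.Properties using (_≟_; toℕ-injective; any?; suc-injective)
  open import Data.Bool using (Bool; true; false; _∧_; _∨_; not)
  open import Data.Bool.Properties using (∧-zeroʳ)
  open import Relation.Binary.Definitions using (tri<; tri≈; tri>)
  open import Data.Product using (Σ; _,_; proj₂)
  open import Data.Sum using (_⊎_; inj₁; inj₂)
  open import Data.Empty using (⊥-elim)
  open import Relation.Nullary using (¬_; yes; no; Dec)
  open import Relation.Nullary.Decidable using (⌊_⌋)
  open import Relation.Binary.PropositionalEquality
  open import Function using (_∘_)
  open import Function.Bundles using (_↔_; Inverse)

  [_]⁰¹ : Bool → ℕ
  [ true ]⁰¹ = 1
  [ false ]⁰¹ = 0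

  count : ∀ {c} → (Fin c → Bool) → ℕ
  count {zero} P = 0
  count {suc c} P = [ P F.zero ]⁰¹ + count (P ∘ F.suc)

  count-cong : ∀ {c} (P Q : Fin c → Bool) → (∀ i → P i ≡ Q i) → count P ≡ count Q
  count-cong {zero} P Q e = refl
  count-cong {suc c} P Q e =
    cong₂ _+_ (cong [_]⁰¹ (e F.zero)) (count-cong (P ∘ F.suc) (Q ∘ F.suc) (e ∘ F.suc))

  count-split : ∀ {c} (P Q : Fin c → Bool) →
    count P ≡ count (λ i → P i ∧ Q i) + count (λ i → P i ∧ not (Q i))
  count-split {zero} P Q = refl
  count-split {suc c} P Q with P F.zero | Q F.zero
  ... | false | _ = count-split (P ∘ F.suc) (Q ∘ F.suc)
  ... | true | true = cong suc (count-split (P ∘ F.suc) (Q ∘ F.suc))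
  ... | true | false = trans (cong suc (count-split (P ∘ F.suc) (Q ∘ F.suc))) (sym (+-suc _ _))

  count-mono : ∀ {c} (P Q : Fin c → Bool) → (∀ i → P i ≡ true → Q i ≡ true) → count P ≤ count Q
  count-mono {zero} P Q h = z≤n
  count-mono {suc c} P Q h = +-mono-≤ (head (P F.zero) (Q F.zero) (h F.zero))
                                       (count-mono (P ∘ F.suc) (Q ∘ F.suc) (h ∘ F.suc))
    where
    head : ∀ a b → (a ≡ true → b ≡ true) → [ a ]⁰¹ ≤ [ b ]⁰¹
    head false b h = z≤n
    head true b h rewrite h refl = ≤-refl

  count-all : ∀ c → count {c} (λ _ → true) ≡ c
  count-all zero = refl
  count-all (suc c) = cong suc (count-all c)

  count-none : ∀ {c} (P : Fin c → Bool) → (∀ i → P i ≡ false) → count P ≡ 0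
  count-none {zero} P h = refl
  count-none {suc c} P h rewrite h F.zero = count-none (P ∘ F.suc) (h ∘ F.suc)

  _==_ : ∀ {c} → Fin c → Fin c → Bool
  i == j = ⌊ i ≟ j ⌋

  ==-refl : ∀ {c} (i : Fin c) → (i == i) ≡ true
  ==-refl i with i ≟ i
  ... | yes _ = refl
  ... | no ne = ⊥-elim (ne refl)

  ==-sound : ∀ {c} {i j : Fin c} → (i == j) ≡ true → i ≡ j
  ==-sound {i = i} {j} h with i ≟ j
  ... | yes e = e

  ==-false : ∀ {c} {i j : Fin c} → ¬ i ≡ j → (i == j) ≡ false
  ==-false {i = i} {j} ne with i ≟ j
  ... | yes e = ⊥-elim (ne e)
  ... | no _ = refl

  true≢false : ¬ true ≡ false
  true≢false ()

  not==-sound : ∀ {c} {i a : Fin c} → not (i == a) ≡ true → ¬ i ≡ a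
  not==-sound {i = i} h refl = true≢false (sym (trans (sym (cong not (==-refl i))) h))

  not==-complete : ∀ {c} {i a : Fin c} → ¬ i ≡ a → not (i == a) ≡ true
  not==-complete ne = cong not (==-false ne)

  count-singleton : ∀ {c} (a : Fin c) → count (_== a) ≡ 1
  count-singleton {suc c} F.zero = cong suc (count-none {c} _ (λ i → ==-false {i = F.suc i} {F.zero} λ ()))
  count-singleton {suc c} (F.suc a) =
    trans (count-cong _ _ (λ i → shift i (i ≟ a))) (count-singleton a)
    where
    shift : ∀ i → Dec (i ≡ a) → (F.suc i == F.suc a) ≡ (i == a)
    shift i (yes refl) = trans (==-refl (F.suc i)) (sym (==-refl i))
    shift i (no ne) = trans (==-false (ne ∘ suc-injective)) (sym (==-false ne))

  count-co-singleton : ∀ {c} (a : Fin c) → count (λ i → not (i == a)) ≡ c ∸ 1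
  count-co-singleton {c} a = begin
      count (λ i → not (i == a))
    ≡⟨ sym (m+n∸m≡n 1 _) ⟩
      (1 + count (λ i → not (i == a))) ∸ 1
    ≡⟨ cong (λ z → (z + count (λ i → not (i == a))) ∸ 1) (sym (count-singleton a)) ⟩
      (count (_== a) + count (λ i → not (i == a))) ∸ 1
    ≡⟨ cong (_∸ 1) (sym (count-split (λ _ → true) (_== a))) ⟩
      count {c} (λ _ → true) ∸ 1
    ≡⟨ cong (_∸ 1) (count-all c) ⟩
      c ∸ 1 ∎
    where open ≡-Reasoning

  count-zero⇒empty : ∀ {c} (P : Fin c → Bool) → count P ≡ 0 → ∀ i → P i ≡ false
  count-zero⇒empty P h i with P i in eq
  ... | false = refl
  ... | true = ⊥-elim (1+n≰n (≤-trans one (≤-reflexive h)))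
    where
    one : 1 ≤ count P
    one = ≤-trans (≤-reflexive (sym (count-singleton i)))
                  (count-mono _ P (λ j e → subst (λ z → P z ≡ true) (sym (==-sound e)) eq))

  nonempty-or-empty : ∀ {c} (P : Fin c → Bool) → (∀ i → P i ≡ false) ⊎ Σ (Fin c) (λ i → P i ≡ true)
  nonempty-or-empty P with any? (λ i → P i Data.Bool.≟ true)
    where import Data.Bool
  ... | yes w = inj₂ w
  ... | no none = inj₁ λ i → ¬true (λ e → none (i , e))
    where
    ¬true : ∀ {b} → ¬ b ≡ true → b ≡ false
    ¬true {false} _ = refl
    ¬true {true} ne = ⊥-elim (ne refl)

  ⊆-by-count : ∀ {c} (P R : Fin c → Bool) → (∀ i → P i ≡ true → R i ≡ true) →
    count R ≤ count P → ∀ i → R i ≡ true → P i ≡ true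
  ⊆-by-count P R P⊆R le i Ri with P i in eq
  ... | true = refl
  ... | false = ⊥-elim (true≢false (trans (sym (in-difference Ri eq)) (count-zero⇒empty _ difference-empty i)))
    where
    in-difference : ∀ {a b} → a ≡ true → b ≡ false → (a ∧ not b) ≡ true
    in-difference refl refl = refl
    P≤R∩P : count P ≤ count (λ j → R j ∧ P j)
    P≤R∩P = count-mono _ _ (λ j h → subst (λ z → (z ∧ P j) ≡ true) (sym (P⊆R j h)) h)
    difference-empty : count (λ j → R j ∧ not (P j)) ≡ 0
    difference-empty = n≤0⇒n≡0 (+-cancelˡ-≤ (count (λ j → R j ∧ P j)) _ _
      (≤-trans (≤-reflexive (sym (count-split R P)))
               (≤-trans le (≤-trans P≤R∩P (≤-reflexive (sym (+-identityʳ _)))))))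

  image : ∀ {m c} → (Fin m → Fin c) → Fin c → Bool
  image {zero} f i = false
  image {suc m} f i = (i == f F.zero) ∨ image (f ∘ F.suc) i

  image-intro : ∀ {m c} (f : Fin m → Fin c) j → image f (f j) ≡ true
  image-intro f F.zero rewrite ==-refl (f F.zero) = refl
  image-intro f (F.suc j) rewrite image-intro (f ∘ F.suc) j with f (F.suc j) == f F.zero
  ... | true = refl
  ... | false = refl

  image-elim : ∀ {m c} (f : Fin m → Fin c) i → image f i ≡ true → Σ (Fin m) λ j → f j ≡ i
  image-elim {suc m} f i h with i == f F.zero in eq
  ... | true = F.zero , sym (==-sound eq)
  ... | false with image-elim (f ∘ F.suc) i h
  ...   | j , e = F.suc j , e

  count-image-injective : ∀ {m c} (f : Fin m → Fin c) → (∀ i j → f i ≡ f j → i ≡ j) →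
    count (image f) ≡ m
  count-image-injective {zero} {c} f inj = count-none {c} _ (λ _ → refl)
  count-image-injective {suc m} {c} f inj = begin
      count (image f)
    ≡⟨ count-split (image f) (_== f₀) ⟩
      count (λ i → image f i ∧ (i == f₀)) + count (λ i → image f i ∧ not (i == f₀))
    ≡⟨ cong₂ _+_ (trans (count-cong _ _ at-f₀) (count-singleton f₀))
                 (trans (count-cong _ _ off-f₀)
                        (count-image-injective (f ∘ F.suc) (λ i j e → suc-injective (inj _ _ e)))) ⟩
      suc m ∎
    where
    open ≡-Reasoning
    f₀ = f F.zero
    at-f₀ : ∀ i → (image f i ∧ (i == f₀)) ≡ (i == f₀)
    at-f₀ i with i == f₀
    ... | true = refl
    ... | false = ∧-zeroʳ _
    -- f₀ is not in the image of the tail, by injectivity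
    off-f₀ : ∀ i → (image f i ∧ not (i == f₀)) ≡ image (f ∘ F.suc) i
    off-f₀ i with i == f₀ in eq
    ... | false with image (f ∘ F.suc) i
    ...   | true = refl
    ...   | false = refl
    off-f₀ i | true with ==-sound eq
    ... | refl with image (f ∘ F.suc) f₀ in eq₂
    ...   | false = refl
    ...   | true with inj _ _ (proj₂ (image-elim (f ∘ F.suc) _ eq₂))
    ...     | ()

  count-image-≤ : ∀ {m c} (f : Fin m → Fin c) → count (image f) ≤ m
  count-image-≤ {zero} {c} f = ≤-reflexive (count-none {c} _ (λ _ → refl))
  count-image-≤ {suc m} {c} f = begin
      count (image f)
    ≡⟨ count-split (image f) (_== f₀) ⟩
      count (λ i → image f i ∧ (i == f₀)) + count (λ i → image f i ∧ not (i == f₀))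
    ≤⟨ +-mono-≤ (≤-trans (count-mono _ _ at-f₀) (≤-reflexive (count-singleton f₀)))
                (≤-trans (count-mono _ _ off-f₀) (count-image-≤ (f ∘ F.suc))) ⟩
      suc m ∎
    where
    open ≤-Reasoning
    f₀ = f F.zero
    at-f₀ : ∀ i → (image f i ∧ (i == f₀)) ≡ true → (i == f₀) ≡ true
    at-f₀ i h with image f i
    ... | true = h
    off-f₀ : ∀ i → (image f i ∧ not (i == f₀)) ≡ true → image (f ∘ F.suc) i ≡ true
    off-f₀ i h with i == f₀
    ... | false with image (f ∘ F.suc) i
    ...   | true = refl

  ↔-injective : ∀ {A B : Set} (e : A ↔ B) {x y} → Inverse.to e x ≡ Inverse.to e y → x ≡ y
  ↔-injective e {x} {y} p = trans (sym (strictlyInverseʳ x)) (trans (cong from p) (strictlyInverseʳ y))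
    where open Inverse e

  ↔-from-injective : ∀ {A B : Set} (e : A ↔ B) {x y} → Inverse.from e x ≡ Inverse.from e y → x ≡ y
  ↔-from-injective e {x} {y} p = trans (sym (strictlyInverseˡ x)) (trans (cong to p) (strictlyInverseˡ y))
    where open Inverse e

  injective-by-order : ∀ {m} {A : Set} (f : Fin m → A) →
    (∀ {i j} → toℕ i < toℕ j → ¬ f i ≡ f j) → ∀ i j → f i ≡ f j → i ≡ j
  injective-by-order f separate i j e with <-cmp (toℕ i) (toℕ j)
  ... | tri≈ _ eq _ = toℕ-injective eq
  ... | tri< lt _ _ = ⊥-elim (separate lt e)
  ... | tri> _ _ gt = ⊥-elim (separate gt (sym e))

module NatFacts where

  open import Data.Nat as ℕ using (ℕ; zero; suc; _+_; _*_; _∸_; _^_; _≤_; _<_; s≤s)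
  open import Data.Nat.Properties
  open import Data.Nat.DivMod using (_/_; m*n/n≡m)
  open import Data.Product using (Σ; _×_; _,_)
  open import Data.Sum using (_⊎_; inj₁; inj₂)
  open import Data.Empty using (⊥-elim)
  open import Relation.Nullary using (¬_; Dec; yes; no)
  open import Relation.Binary.PropositionalEquality

  least : (P : ℕ → Set) → (∀ n → Dec (P n)) → ∀ {n} → P n →
    Σ ℕ λ m → P m × (∀ k → k < m → ¬ P k)
  least P P? {n} Pn with search (suc n)
    where
    search : ∀ b → (∀ k → k < b → ¬ P k) ⊎ Σ ℕ (λ m → P m × (∀ k → k < m → ¬ P k))
    search zero = inj₁ (λ k ())
    search (suc b) with search b
    ... | inj₂ found = inj₂ found
    ... | inj₁ below with P? b
    ...   | yes Pb = inj₂ (b , Pb , below)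
    ...   | no ¬Pb = inj₁ λ k k<sb → case (m≤n⇒m<n∨m≡n (≤-pred k<sb))
      where
      case : ∀ {k} → k < b ⊎ k ≡ b → ¬ P k
      case (inj₁ lt) = below _ lt
      case (inj₂ refl) = ¬Pb
  ... | inj₂ found = found
  ... | inj₁ none = ⊥-elim (none n ≤-refl Pn)

  module PowersOf (q₁ : ℕ) where
    q : ℕ
    q = suc q₁

    geometric : ℕ → ℕ
    geometric zero = 0
    geometric (suc n) = q ^ n + geometric n

    geometric-sum : ∀ n → suc (q₁ * geometric n) ≡ q ^ n
    geometric-sum zero = cong suc (*-zeroʳ q₁)
    geometric-sum (suc n) = begin
        suc (q₁ * (q ^ n + geometric n))     ≡⟨ cong suc (*-distribˡ-+ q₁ (q ^ n) (geometric n)) ⟩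
        suc (q₁ * q ^ n + q₁ * geometric n)  ≡⟨ sym (+-suc _ _) ⟩
        q₁ * q ^ n + suc (q₁ * geometric n)  ≡⟨ cong (q₁ * q ^ n +_) (geometric-sum n) ⟩
        q₁ * q ^ n + q ^ n                   ≡⟨ +-comm (q₁ * q ^ n) (q ^ n) ⟩
        q ^ suc n                            ∎
      where open ≡-Reasoning

    -- for n ≥ 2 the sum has at least the two terms 1 and q
    geometric≥2 : ∀ n → 2 ≤ n → 2 ≤ geometric n
    geometric≥2 (suc zero) (s≤s ())
    geometric≥2 (suc (suc n)) _ = +-mono-≤ (m^n>0 q (suc n)) (≤-trans (m^n>0 q n) (m≤m+n _ _))

    ^-pred : ∀ d → suc (q ^ d ∸ 1) ≡ q ^ d
    ^-pred d = m+[n∸m]≡n {1} (m^n>0 q d)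

    module _ (k : ℕ) where
      open import Data.Nat.Divisibility using (_∣_; ∣m+n∣m⇒∣n; ∣n⇒∣m*n; ∣m⇒∣m*n)
      open import Data.Nat.Tactic.RingSolver using (solve-∀)

      private
        Q : ℕ
        Q = q ^ (2 * k + 1)

        Q≡ : Q ≡ q * (q ^ k * q ^ k)
        Q≡ = trans (cong (q ^_) (exponent k)) (cong (q *_) (^-distribˡ-+-* q k k))
          where
          exponent : ∀ k → 2 * k + 1 ≡ 1 + (k + k)
          exponent = solve-∀

      common-divisor-of-k : ∀ M → M ∣ q ^ k ∸ 1 → M ∣ Q ∸ 1 → M ∣ q₁
      common-divisor-of-k M M∣a M∣Q = ∣m+n∣m⇒∣n (subst (M ∣_) Q∸1≡ M∣Q) (∣n⇒∣m*n q (∣m⇒∣m*n (a + 2) M∣a))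
        where
        a = q ^ k ∸ 1
        identity : ∀ q₁ a → suc q₁ * (suc a * suc a) ≡ suc (suc q₁ * (a * (a + 2)) + q₁)
        identity = solve-∀
        Q∸1≡ : Q ∸ 1 ≡ q * (a * (a + 2)) + q₁
        Q∸1≡ = cong (_∸ 1) (trans Q≡ (trans (cong (λ z → q * (z * z)) (sym (^-pred k))) (identity q₁ a)))

      common-divisor-of-suc-k : ∀ M → M ∣ q ^ suc k ∸ 1 → M ∣ Q ∸ 1 → M ∣ q₁
      common-divisor-of-suc-k M M∣b M∣Q = ∣m+n∣m⇒∣n (subst (M ∣_) b[b+2]≡ (∣m⇒∣m*n (b + 2) M∣b)) (∣n⇒∣m*n q M∣Q)
        where
        b = q ^ suc k ∸ 1
        square : ∀ b → suc b * suc b ≡ suc (b * (b + 2))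
        square = solve-∀
        identity : ∀ q₁ Q₁ → suc q₁ * suc Q₁ ≡ suc (suc q₁ * Q₁ + q₁)
        identity = solve-∀
        b²≡qQ : q ^ suc k * q ^ suc k ≡ q * Q
        b²≡qQ = trans (sym (^-distribˡ-+-* q (suc k) (suc k))) (cong (q ^_) (exponent k))
          where
          exponent : ∀ k → suc k + suc k ≡ suc (2 * k + 1)
          exponent = solve-∀
        b[b+2]≡ : b * (b + 2) ≡ q * (Q ∸ 1) + q₁
        b[b+2]≡ = suc-injective (begin
            suc (b * (b + 2))          ≡⟨ sym (square b) ⟩
            suc b * suc b              ≡⟨ cong (λ z → z * z) (^-pred (suc k)) ⟩
            q ^ suc k * q ^ suc k      ≡⟨ b²≡qQ ⟩
            q * Q                      ≡⟨ cong (q *_) (sym (^-pred (2 * k + 1))) ⟩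
            q * suc (Q ∸ 1)            ≡⟨ identity q₁ (Q ∸ 1) ⟩
            suc (q * (Q ∸ 1) + q₁)     ∎)
          where open ≡-Reasoning

  gauss-geometric : ∀ q₂ n → gauss (suc (suc q₂)) n ≡ PowersOf.geometric (suc q₂) n
  gauss-geometric q₂ n = begin
      (suc (suc q₂) ^ n ∸ 1) / suc q₂          ≡⟨ cong (λ z → (z ∸ 1) / suc q₂) (sym (geometric-sum n)) ⟩
      (suc q₂ * geometric n) / suc q₂          ≡⟨ cong (_/ suc q₂) (*-comm (suc q₂) (geometric n)) ⟩
      (geometric n * suc q₂) / suc q₂          ≡⟨ m*n/n≡m (geometric n) (suc q₂) ⟩
      geometric n                              ∎
    where
    open ≡-Reasoning
    open PowersOf (suc q₂)

module Orbits where

  open Counting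
  open import Data.Nat as ℕ using (ℕ; zero; suc; _+_; _*_; _∸_; _≤_; _<_; s≤s)
  open import Data.Nat.Properties hiding (_≟_)
  open import Data.Nat.Divisibility using (_∣_; ∣-refl; ∣m∣n⇒∣m+n; divides)
  open import Data.Nat.DivMod using (_%_; _/_; m≡m%n+[m/n]*n; m%n<n)
  open import Data.Fin as F using (Fin; toℕ; fromℕ<)
  open import Data.Fin.Properties using (toℕ<n; toℕ-fromℕ<)
  open import Data.Bool using (Bool; true; false; _∧_; not)
  open import Data.Bool.Properties using (∧-zeroʳ; ∧-conicalˡ)
  open import Data.Product using (_,_)
  open import Data.Sum using (inj₁; inj₂)
  open import Data.Empty using (⊥-elim)
  open import Relation.Nullary using (¬_)
  open import Relation.Binary.PropositionalEquality
  open import Function using (_∘_)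
  open import Function.Bundles using (_↔_; Inverse)

  iter : ∀ {A : Set} → (A → A) → ℕ → A → A
  iter f zero x = x
  iter f (suc n) x = f (iter f n x)

  iter-+ : ∀ {A : Set} (f : A → A) a b x → iter f (a + b) x ≡ iter f a (iter f b x)
  iter-+ f zero b x = refl
  iter-+ f (suc a) b x = cong f (iter-+ f a b x)

  -- A map of period M on Fin c: the number of points of an invariant set on which
  -- the map acts freely is a multiple of M (the set is a disjoint union of orbits).
  module OrbitCounting {c} (σ : Fin c → Fin c) (M' : ℕ)
                       (periodic : ∀ x → iter σ (suc M') x ≡ x) where

    M : ℕ
    M = suc M'

    iter-multiple : ∀ m x → iter σ (m * M) x ≡ x
    iter-multiple zero x = refl
    iter-multiple (suc m) x =
      trans (iter-+ σ M (m * M) x) (trans (cong (iter σ M) (iter-multiple m x)) (periodic x))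

    iter-mod : ∀ j x → iter σ j x ≡ iter σ (j % M) x
    iter-mod j x = begin
        iter σ j x
      ≡⟨ cong (λ z → iter σ z x) (m≡m%n+[m/n]*n j M) ⟩
        iter σ (j % M + (j / M) * M) x
      ≡⟨ iter-+ σ (j % M) _ x ⟩
        iter σ (j % M) (iter σ ((j / M) * M) x)
      ≡⟨ cong (iter σ (j % M)) (iter-multiple (j / M) x) ⟩
        iter σ (j % M) x ∎
      where open ≡-Reasoning

    orbit : Fin c → Fin M → Fin c
    orbit x j = iter σ (toℕ j) x

    in-orbit : ∀ x j → image (orbit x) (iter σ j x) ≡ true
    in-orbit x j = subst (λ y → image (orbit x) y ≡ true)
      (trans (cong (λ z → iter σ z x) (toℕ-fromℕ< (m%n<n j M))) (sym (iter-mod j x)))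
      (image-intro (orbit x) (fromℕ< (m%n<n j M)))

    -- an orbit is closed under σ⁻¹ = σ^(M-1)
    orbit-backward : ∀ x y → image (orbit x) (σ y) ≡ true → image (orbit x) y ≡ true
    orbit-backward x y h with image-elim (orbit x) (σ y) h
    ... | j , e = subst (λ z → image (orbit x) z ≡ true) y≡ (in-orbit x (M' + toℕ j))
      where
      y≡ : iter σ (M' + toℕ j) x ≡ y
      y≡ = begin
          iter σ (M' + toℕ j) x
        ≡⟨ iter-+ σ M' (toℕ j) x ⟩
          iter σ M' (orbit x j)
        ≡⟨ cong (iter σ M') e ⟩
          iter σ M' (σ y)
        ≡⟨ sym (iter-+ σ M' 1 y) ⟩
          iter σ (M' + 1) y
        ≡⟨ cong (λ z → iter σ z y) (+-comm M' 1) ⟩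
          iter σ M y
        ≡⟨ periodic y ⟩
          y ∎
        where open ≡-Reasoning

    FreeOn : (Fin c → Bool) → Set
    FreeOn S = ∀ x → S x ≡ true → ∀ j → 0 < j → j < M → ¬ iter σ j x ≡ x

    Invariant : (Fin c → Bool) → Set
    Invariant S = ∀ x → S x ≡ true → S (σ x) ≡ true

    iterate-in : ∀ S → Invariant S → ∀ x → S x ≡ true → ∀ n → S (iter σ n x) ≡ true
    iterate-in S inv x Sx zero = Sx
    iterate-in S inv x Sx (suc n) = inv _ (iterate-in S inv x Sx n)

    -- on an invariant set with free action, no point returns to a previous position
    -- of its orbit before time M: σ^(b-a) would fix the point σ^a x of S
    no-return : ∀ S → Invariant S → FreeOn S → ∀ x → S x ≡ true →
      ∀ {a b} → a < b → b < M → ¬ iter σ a x ≡ iter σ b x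
    no-return S inv free x Sx {a} {b} a<b b<M e =
      free (iter σ a x) (iterate-in S inv x Sx a) (b ∸ a) (m<n⇒0<n∸m a<b) (≤-<-trans (m∸n≤m b a) b<M)
        (trans (sym (iter-+ σ (b ∸ a) a x)) (trans (cong (λ z → iter σ z x) (m∸n+n≡m (<⇒≤ a<b))) (sym e)))

    orbit-injective : ∀ S → Invariant S → FreeOn S → ∀ x → S x ≡ true →
      ∀ i j → orbit x i ≡ orbit x j → i ≡ j
    orbit-injective S inv free x Sx =
      injective-by-order (orbit x) (λ {i} {j} lt → no-return S inv free x Sx lt (toℕ<n j))

    private
      remove : (Fin c → Bool) → Fin c → Fin c → Bool
      remove S x y = S y ∧ not (image (orbit x) y)

      remove-invariant : ∀ S x → Invariant S → Invariant (remove S x)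
      remove-invariant S x inv y h with S y in Sy | image (orbit x) y in notin
      ... | true | false with image (orbit x) (σ y) in eq
      ...   | true = ⊥-elim (true≢false (trans (sym (orbit-backward x y eq)) notin))
      ...   | false rewrite inv y Sy = refl

      count-remove : ∀ S → Invariant S → FreeOn S → ∀ x → S x ≡ true → count S ≡ M + count (remove S x)
      count-remove S inv free x Sx =
        trans (count-split S O) (cong (_+ count (remove S x))
          (trans (count-cong _ _ S∧O) (count-image-injective (orbit x) (orbit-injective S inv free x Sx))))
        where
        O = image (orbit x)
        S∧O : ∀ y → (S y ∧ O y) ≡ O y
        S∧O y with O y in eq
        ... | false = ∧-zeroʳ (S y)
        ... | true with image-elim (orbit x) y eq
        ...   | j , refl rewrite iterate-in S inv x Sx (toℕ j) = refl

    orbit-lemma : ∀ S → Invariant S → FreeOn S → M ∣ count S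
    orbit-lemma S = go (count S) S ≤-refl
      where
      go : ∀ fuel S → count S ≤ fuel → Invariant S → FreeOn S → M ∣ count S
      go fuel S bound inv free with nonempty-or-empty S
      ... | inj₁ empty rewrite count-none S empty = divides 0 refl
      go zero S bound inv free | inj₂ (x , Sx) =
        ⊥-elim (1+n≰n (≤-trans (≤-trans (m≤m+n 1 M') (m≤m+n M _)) (≤-trans (≤-reflexive (sym (count-remove S inv free x Sx))) bound)))
      go (suc fuel) S bound inv free | inj₂ (x , Sx) =
        subst (M ∣_) (sym eqS) (∣m∣n⇒∣m+n ∣-refl
          (go fuel (remove S x) bound′ (remove-invariant S x inv) (λ y h → free y (∧-conicalˡ _ _ h))))
        where
        eqS = count-remove S inv free x Sx
        bound′ : count (remove S x) ≤ fuel
        bound′ = ≤-pred (≤-trans (s≤s (m≤n+m _ M')) (subst (_≤ suc fuel) eqS bound))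

  module _ {A : Set} {c : ℕ} (e : A ↔ Fin c) where
    open Inverse e

    period-divides : (σ : A → A) (M' : ℕ) (a₀ : A) →
      (∀ x → iter σ (suc M') x ≡ x) →
      (∀ x → ¬ x ≡ a₀ → ¬ σ x ≡ a₀) →
      (∀ x → ¬ x ≡ a₀ → ∀ j → 0 < j → j < suc M' → ¬ iter σ j x ≡ x) →
      suc M' ∣ c ∸ 1
    period-divides σ M' a₀ periodic keep free =
      subst (suc M' ∣_) (count-co-singleton (to a₀))
        (OrbitCounting.orbit-lemma σ′ M' periodic′ S invariant free′)
      where
      σ′ : Fin c → Fin c
      σ′ i = to (σ (from i))
      iter′ : ∀ n i → iter σ′ n i ≡ to (iter σ n (from i))
      iter′ zero i = sym (strictlyInverseˡ i)
      iter′ (suc n) i = trans (cong (to ∘ σ ∘ from) (iter′ n i)) (cong (to ∘ σ) (strictlyInverseʳ _))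
      periodic′ : ∀ i → iter σ′ (suc M') i ≡ i
      periodic′ i = trans (iter′ (suc M') i) (trans (cong to (periodic (from i))) (strictlyInverseˡ i))
      S : Fin c → Bool
      S i = not (i == to a₀)
      away : ∀ i → S i ≡ true → ¬ from i ≡ a₀
      away i h e = not==-sound h (trans (sym (strictlyInverseˡ i)) (cong to e))
      back : ∀ x → ¬ x ≡ a₀ → S (to x) ≡ true
      back x ne = not==-complete (ne ∘ ↔-injective e)
      invariant : OrbitCounting.Invariant σ′ M' periodic′ S
      invariant i h = back _ (keep _ (away i h))
      free′ : OrbitCounting.FreeOn σ′ M' periodic′ S
      free′ i h j p q eq = free (from i) (away i h) j p q
        (↔-injective e (trans (sym (iter′ j i)) (trans eq (sym (strictlyInverseˡ i)))))

module FieldFacts (F : Field) where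

  open import Level using (0ℓ)
  open NatFacts
  open Counting using (↔-injective; count; _==_; ==-refl; not==-sound; count-co-singleton; count-mono; count-singleton; image; image-intro; count-image-≤)
  open Orbits using (iter; period-divides)
  open import Data.Nat as ℕ using (ℕ; zero; suc; _≤_; _<_; _∸_; z≤n; s≤s; NonZero)
  open import Data.Nat.Properties as ℕP using (*-zeroʳ; *-suc; <⇒≤; m+[n∸m]≡n; n<1+n)
  open import Data.Nat.Divisibility as ND using (_∣_; divides; m%n≡0⇒n∣m; *-cancelˡ-∣)
  open import Data.Nat.DivMod using (_/_; _%_; m≡m%n+[m/n]*n; m%n<n)
  open import Data.Bool using (Bool; true; false; not)
  open import Data.Sum using (_⊎_; inj₁; inj₂)
  open import Data.Fin as Fin using (Fin; toℕ)
  open import Data.Fin.Properties as FP using (pigeonhole; toℕ-fromℕ<)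
  open import Data.Product using (Σ; _,_)
  open import Data.Empty using (⊥-elim)
  open import Relation.Nullary using (¬_; yes; no; Dec)
  open import Relation.Binary.PropositionalEquality
  open import Function using (_∘_)
  open import Function.Bundles using (_↔_; Inverse)
  open import Algebra.Structures using (IsCommutativeRing)
  open import Algebra.Bundles using (CommutativeRing)
  import Algebra.Properties.Ring as RingProperties

  open Field F public
  open IsCommutativeRing isCommutativeRing public
    using (*-assoc; *-comm; *-identityˡ; *-identityʳ; zeroˡ; zeroʳ; distribˡ; distribʳ;
           +-assoc; +-comm; +-identityˡ; +-identityʳ; -‿inverseʳ; -‿inverseˡ)

  ring : CommutativeRing 0ℓ 0ℓ
  ring = record { isCommutativeRing = isCommutativeRing }

  open RingProperties (CommutativeRing.ring ring) public
    using (+-cancelˡ; -0#≈0#; -‿+-comm; -‿distribˡ-*; x∙y⁻¹≈ε⇒x≈y)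

  inverseˡ : ∀ x → ¬ x ≡ 0# → x ⁻¹ * x ≡ 1#
  inverseˡ x nz = trans (*-comm _ _) (inverseʳ x nz)

  1≢0 : ¬ 1# ≡ 0#
  1≢0 e = 0≢1 (sym e)

  cancelˡ : ∀ x {y z} → ¬ x ≡ 0# → x * y ≡ x * z → y ≡ z
  cancelˡ x {y} {z} nz e = begin
      y                  ≡⟨ sym (*-identityˡ y) ⟩
      1# * y             ≡⟨ cong (_* y) (sym (inverseˡ x nz)) ⟩
      (x ⁻¹ * x) * y     ≡⟨ *-assoc _ _ _ ⟩
      x ⁻¹ * (x * y)     ≡⟨ cong (x ⁻¹ *_) e ⟩
      x ⁻¹ * (x * z)     ≡⟨ sym (*-assoc _ _ _) ⟩
      (x ⁻¹ * x) * z     ≡⟨ cong (_* z) (inverseˡ x nz) ⟩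
      1# * z             ≡⟨ *-identityˡ z ⟩
      z                  ∎
    where open ≡-Reasoning

  cancelʳ : ∀ x {y z} → ¬ x ≡ 0# → y * x ≡ z * x → y ≡ z
  cancelʳ x nz e = cancelˡ x nz (trans (*-comm _ _) (trans e (*-comm _ _)))

  *-nonzero : ∀ {x y} → ¬ x ≡ 0# → ¬ y ≡ 0# → ¬ x * y ≡ 0#
  *-nonzero {x} nx ny e = ny (cancelˡ x nx (trans e (sym (zeroʳ x))))

  ^-+ : ∀ x a b → x ^ᴺ (a ℕ.+ b) ≡ x ^ᴺ a * x ^ᴺ b
  ^-+ x zero b = sym (*-identityˡ _)
  ^-+ x (suc a) b = trans (cong (x *_) (^-+ x a b)) (sym (*-assoc _ _ _))

  ^-* : ∀ x a b → x ^ᴺ (a ℕ.* b) ≡ (x ^ᴺ a) ^ᴺ b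
  ^-* x a zero = cong (x ^ᴺ_) (*-zeroʳ a)
  ^-* x a (suc b) = trans (cong (x ^ᴺ_) (*-suc a b)) (trans (^-+ x a (a ℕ.* b)) (cong (x ^ᴺ a *_) (^-* x a b)))

  1^ : ∀ n → 1# ^ᴺ n ≡ 1#
  1^ zero = refl
  1^ (suc n) = trans (*-identityˡ _) (1^ n)

  ^-nonzero : ∀ x n → ¬ x ≡ 0# → ¬ x ^ᴺ n ≡ 0#
  ^-nonzero x zero nz = 1≢0
  ^-nonzero x (suc n) nz = *-nonzero nz (^-nonzero x n nz)

  ^-difference : ∀ x → ¬ x ≡ 0# → ∀ {a b} → a ≤ b → x ^ᴺ a ≡ x ^ᴺ b → x ^ᴺ (b ∸ a) ≡ 1#
  ^-difference x nz {a} {b} a≤b e = cancelˡ (x ^ᴺ a) (^-nonzero x a nz) (begin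
      x ^ᴺ a * x ^ᴺ (b ∸ a)   ≡⟨ sym (^-+ x a (b ∸ a)) ⟩
      x ^ᴺ (a ℕ.+ (b ∸ a))    ≡⟨ cong (x ^ᴺ_) (m+[n∸m]≡n a≤b) ⟩
      x ^ᴺ b                  ≡⟨ sym e ⟩
      x ^ᴺ a                  ≡⟨ sym (*-identityʳ _) ⟩
      x ^ᴺ a * 1#             ∎)
    where open ≡-Reasoning

  ^-1-multiple : ∀ x o → x ^ᴺ o ≡ 1# → ∀ j → x ^ᴺ (o ℕ.* j) ≡ 1#
  ^-1-multiple x o xo j = trans (^-* x o j) (trans (cong (_^ᴺ j) xo) (1^ j))

  iter-* : ∀ x n y → iter (x *_) n y ≡ x ^ᴺ n * y
  iter-* x zero y = sym (*-identityˡ y)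
  iter-* x (suc n) y = trans (cong (x *_) (iter-* x n y)) (sym (*-assoc _ _ _))

  record HasOrder (x : Carrier) (o : ℕ) : Set where
    field
      positive : 0 < o
      returns : x ^ᴺ o ≡ 1#
      minimal : ∀ j → 0 < j → j < o → ¬ x ^ᴺ j ≡ 1#

  module _ {x o} (ord : HasOrder x o) where
    open HasOrder ord
    private instance
      o≢0 : NonZero o
      o≢0 = ℕ.>-nonZero positive

    ^-mod : ∀ j → x ^ᴺ j ≡ x ^ᴺ (j % o)
    ^-mod j = begin
        x ^ᴺ j                                  ≡⟨ cong (x ^ᴺ_) (m≡m%n+[m/n]*n j o) ⟩
        x ^ᴺ (j % o ℕ.+ (j / o) ℕ.* o)           ≡⟨ ^-+ x (j % o) _ ⟩
        x ^ᴺ (j % o) * x ^ᴺ ((j / o) ℕ.* o)      ≡⟨ cong (λ z → x ^ᴺ (j % o) * x ^ᴺ z) (ℕP.*-comm (j / o) o) ⟩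
        x ^ᴺ (j % o) * x ^ᴺ (o ℕ.* (j / o))      ≡⟨ cong (x ^ᴺ (j % o) *_) (^-1-multiple x o returns (j / o)) ⟩
        x ^ᴺ (j % o) * 1#                        ≡⟨ *-identityʳ _ ⟩
        x ^ᴺ (j % o)                             ∎
      where open ≡-Reasoning

    -- x^j = 1 forces o ∣ j, since the remainder of j would be a smaller period
    order-divides : ∀ j → x ^ᴺ j ≡ 1# → o ∣ j
    order-divides j h = m%n≡0⇒n∣m j o (remainder-zero (j % o) refl)
      where
      remainder-zero : ∀ r → r ≡ j % o → r ≡ 0
      remainder-zero zero _ = refl
      remainder-zero (suc r) eq = ⊥-elim (minimal (suc r) (s≤s z≤n) (subst (_< o) (sym eq) (m%n<n j o))
                                   (trans (cong (x ^ᴺ_) eq) (trans (sym (^-mod j)) h)))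

    order-of-power : ∀ s m → 0 < m → s ℕ.* m ≡ o → HasOrder (x ^ᴺ s) m
    order-of-power s m m>0 sm≡o = record
      { positive = m>0
      ; returns = trans (sym (^-* x s m)) (trans (cong (x ^ᴺ_) sm≡o) returns)
      ; minimal = λ j j>0 j<m e → ℕP.<⇒≱ j<m (ND.∣⇒≤ ⦃ ℕ.>-nonZero j>0 ⦄
          (*-cancelˡ-∣ s ⦃ nonzero-s ⦄ (subst (_∣ s ℕ.* j) (sym sm≡o) (order-divides _ (trans (^-* x s j) e)))))
      }
      where
      nonzero-s : NonZero s
      nonzero-s = ℕ.≢-nonZero λ { refl → ℕP.<⇒≢ positive sm≡o }

  module Finite (c : ℕ) (size : Carrier ↔ Fin c) where
    open Inverse size

    -- equality is decidable, being equality in Fin c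
    _≟_ : (x y : Carrier) → Dec (x ≡ y)
    x ≟ y with to x FP.≟ to y
    ... | yes p = yes (↔-injective size p)
    ... | no np = no (λ p → np (cong to p))

    -- 0 and 1 are different elements
    two≤size : 2 ≤ c
    two≤size = separated c to (0≢1 ∘ ↔-injective size)
      where
      separated : ∀ n (f : Carrier → Fin n) → ¬ f 0# ≡ f 1# → 2 ≤ n
      separated zero f _ with f 0#
      ... | ()
      separated (suc zero) f ne = ⊥-elim (ne (single (f 0#) (f 1#)))
        where
        single : ∀ (i j : Fin 1) → i ≡ j
        single Fin.zero Fin.zero = refl
      separated (suc (suc n)) _ _ = s≤s (s≤s z≤n)

    -- by pigeonhole x^i = x^j for some i < j ≤ c; the least period is the order
    order : ∀ x → ¬ x ≡ 0# → Σ ℕ (HasOrder x)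
    order x nz with pigeonhole (n<1+n c) (λ j → to (x ^ᴺ toℕ j))
    ... | i , j , i<j , eq with least (λ m → x ^ᴺ suc m ≡ 1#) (λ m → (x ^ᴺ suc m) ≟ 1#) {toℕ j ∸ toℕ i ∸ 1} returns′
      where
      returns′ : x ^ᴺ suc (toℕ j ∸ toℕ i ∸ 1) ≡ 1#
      returns′ = subst (λ m → x ^ᴺ m ≡ 1#) (sym (ℕP.m+[n∸m]≡n {1} (ℕP.m<n⇒0<n∸m i<j)))
        (^-difference x nz (<⇒≤ i<j) (↔-injective size eq))
    ... | o′ , returns , below = suc o′ , record
      { positive = s≤s z≤n
      ; returns = returns
      ; minimal = λ { (suc j) _ (s≤s j<o) → below j j<o }
      }

    -- Lagrange: multiplication by x permutes the nonzero elements in orbits of size o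
    order-divides-size : ∀ {x o} → ¬ x ≡ 0# → HasOrder x o → o ∣ c ∸ 1
    order-divides-size {x} {suc o′} nz ord =
      period-divides size (x *_) o′ 0# periodic keep free
      where
      open HasOrder ord
      periodic : ∀ y → iter (x *_) (suc o′) y ≡ y
      periodic y = trans (iter-* x (suc o′) y) (trans (cong (_* y) returns) (*-identityˡ y))
      keep : ∀ y → ¬ y ≡ 0# → ¬ x * y ≡ 0#
      keep y = *-nonzero nz
      free : ∀ y → ¬ y ≡ 0# → ∀ j → 0 < j → j < suc o′ → ¬ iter (x *_) j y ≡ y
      free y ny j j>0 j<o e = minimal j j>0 j<o
        (cancelʳ y ny (trans (sym (iter-* x j y)) (trans e (sym (*-identityˡ y)))))

    fermat : ∀ x → ¬ x ≡ 0# → x ^ᴺ (c ∸ 1) ≡ 1#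
    fermat x nz with order x nz
    ... | o , ord with order-divides-size nz ord
    ...   | divides m eq =
      trans (cong (x ^ᴺ_) (trans eq (ℕP.*-comm m o))) (^-1-multiple x o (HasOrder.returns ord) m)

    nonzero : Fin c → Bool
    nonzero i = not (i == to 0#)

    nonzero-sound : ∀ i → nonzero i ≡ true → ¬ from i ≡ 0#
    nonzero-sound i h e = not==-sound h (trans (sym (strictlyInverseˡ i)) (cong to e))

    count-nonzero : count nonzero ≡ c ∸ 1
    count-nonzero = count-co-singleton (to 0#)

    primitive-nonzero : 3 ≤ c → ∀ α → Primitive F α → ¬ α ≡ 0#
    primitive-nonzero c≥3 α prim α0 =
      ℕP.<⇒≱ (ℕP.∸-monoˡ-≤ 1 c≥3) (begin
        c ∸ 1                   ≡⟨ sym count-nonzero ⟩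
        count nonzero           ≤⟨ count-mono _ _ only-one ⟩
        count (_== to 1#)       ≡⟨ count-singleton (to 1#) ⟩
        1                       ∎)
      where
      open ℕP.≤-Reasoning
      zero-or-one : ∀ m → α ^ᴺ m ≡ 0# ⊎ α ^ᴺ m ≡ 1#
      zero-or-one zero = inj₂ refl
      zero-or-one (suc m) = inj₁ (trans (cong (_* α ^ᴺ m) α0) (zeroˡ _))
      only-one : ∀ i → nonzero i ≡ true → (i == to 1#) ≡ true
      only-one i h with prim (from i) (nonzero-sound i h)
      ... | m , e with zero-or-one m
      ...   | inj₁ z = ⊥-elim (nonzero-sound i h (trans e z))
      ...   | inj₂ o = subst (λ z → (z == to 1#) ≡ true)
                         (trans (cong to (sym (trans e o))) (strictlyInverseˡ i)) (==-refl _)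

    primitive-order : ∀ α → Primitive F α → ¬ α ≡ 0# → HasOrder α (c ∸ 1)
    primitive-order α prim nz with order α nz
    ... | o , ord = subst (HasOrder α) o≡ ord
      where
      open HasOrder ord
      powers : Fin o → Fin c
      powers j = to (α ^ᴺ toℕ j)
      all-powers : ∀ i → nonzero i ≡ true → image powers i ≡ true
      all-powers i h with prim (from i) (nonzero-sound i h)
      ... | m , e = subst (λ z → image powers z ≡ true) reduced
                      (image-intro powers (Fin.fromℕ< (m%n<n m o ⦃ ℕ.>-nonZero positive ⦄)))
        where
        reduced : powers (Fin.fromℕ< (m%n<n m o ⦃ ℕ.>-nonZero positive ⦄)) ≡ i
        reduced = trans (cong (λ z → to (α ^ᴺ z)) (toℕ-fromℕ< (m%n<n m o ⦃ ℕ.>-nonZero positive ⦄)))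
                    (trans (cong to (sym (trans e (^-mod ord m)))) (strictlyInverseˡ i))
      c∸1≤o : c ∸ 1 ≤ o
      c∸1≤o = ℕP.≤-trans (ℕP.≤-reflexive (sym count-nonzero))
                (ℕP.≤-trans (count-mono _ _ all-powers) (count-image-≤ powers))
      o≡ : o ≡ c ∸ 1
      o≡ = ℕP.≤-antisym (ND.∣⇒≤ ⦃ ℕ.>-nonZero (ℕP.∸-monoˡ-< two≤size (s≤s z≤n)) ⦄ (order-divides-size nz ord)) c∸1≤o

module VectorCount {A : Set} {q : ℕ} (size : A ↔ Fin q) where

  open import Data.Nat using (zero; _^_)
  open import Data.Fin as F using (combine; remQuot)
  import Data.Fin.Properties as FP
  open import Data.Vec using (Vec; []; _∷_)
  open import Data.Product using (proj₁; proj₂)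
  open import Relation.Binary.PropositionalEquality
  open import Function using (_∘_)
  open import Function.Bundles using (Inverse; mk↔ₛ′)

  open Inverse size

  encode : ∀ {d} → Vec A d → Fin (q ^ d)
  encode [] = F.zero
  encode {suc d} (x ∷ v) = combine {q} {q ^ d} (to x) (encode v)

  decode : ∀ {d} → Fin (q ^ d) → Vec A d
  decode {zero} _ = []
  decode {suc d} i = from (proj₁ (remQuot {q} (q ^ d) i)) ∷ decode {d} (proj₂ (remQuot {q} (q ^ d) i))

  encode-decode : ∀ {d} (i : Fin (q ^ d)) → encode (decode {d} i) ≡ i
  encode-decode {zero} F.zero = refl
  encode-decode {suc d} i =
    trans (cong₂ combine (strictlyInverseˡ _) (encode-decode {d} _)) (FP.combine-remQuot {q} (q ^ d) i)

  decode-encode : ∀ {d} (v : Vec A d) → decode (encode v) ≡ v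
  decode-encode [] = refl
  decode-encode {suc d} (x ∷ v) =
    cong₂ _∷_ (trans (cong (from ∘ proj₁) split) (strictlyInverseʳ x))
              (trans (cong (decode {d} ∘ proj₂) split) (decode-encode v))
    where
    split = FP.remQuot-combine {q} {q ^ d} (to x) (encode v)

  vectors : ∀ d → Vec A d ↔ Fin (q ^ d)
  vectors d = mk↔ₛ′ (encode {d}) (decode {d}) (encode-decode {d}) (decode-encode {d})

module Linear {Fq K : Field} (E : Embedding Fq K) where

  open Orbits using (iter; period-divides)
  open import Data.Nat as ℕ using (ℕ; zero; suc; _≤_; _<_; _∸_; z≤n; s≤s)
  import Data.Nat.Properties as ℕP
  open import Data.Nat.Divisibility using (_∣_)
  open import Data.Fin as F using (Fin)
  import Data.Fin.Properties as FP
  open import Data.Vec as V using (Vec; lookup; tabulate)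
  import Data.Vec.Properties as VP
  open import Data.Product using (_,_; proj₁; proj₂)
  open import Data.Empty using (⊥)
  open import Relation.Nullary using (¬_)
  open import Relation.Binary.PropositionalEquality
  open import Function using (_∘_)
  open import Function.Bundles using (Inverse; Equivalence)
  open import Relation.Binary.Bundles using (Setoid)
  import Level
  import Algebra.Properties.CommutativeSemigroup as CommutativeSemigroupProperties
  open import Algebra.Bundles using (CommutativeRing)

  open Embedding E
  open VectorSpace E public
  module Q = FieldFacts Fq
  open FieldFacts K

  open CommutativeSemigroupProperties (CommutativeRing.+-commutativeSemigroup ring)
    using (interchange)

  ι-0 : ι Q.0# ≡ 0#
  ι-0 = +-cancelˡ (ι Q.0#) _ _
    (trans (sym (ι-+ Q.0# Q.0#)) (trans (cong ι (Q.+-identityˡ Q.0#)) (sym (+-identityʳ _))))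

  ι-neg : ∀ a → ι (Q.- a) ≡ - ι a
  ι-neg a = +-cancelˡ (ι a) _ _
    (trans (sym (ι-+ a (Q.- a))) (trans (cong ι (Q.-‿inverseʳ a)) (trans ι-0 (sym (-‿inverseʳ (ι a))))))

  ι-nonzero : ∀ a → ¬ a ≡ Q.0# → ¬ ι a ≡ 0#
  ι-nonzero a nz h = nz (ι-inj a Q.0# (trans h (sym ι-0)))

  ι-^ : ∀ a n → ι (a Q.^ᴺ n) ≡ ι a ^ᴺ n
  ι-^ a zero = ι-1
  ι-^ a (suc n) = trans (ι-* a _) (cong (ι a *_) (ι-^ a n))

  lincomb-cong : ∀ d (c c′ : Fin d → Q.Carrier) b → (∀ i → c i ≡ c′ i) → lincomb d c b ≡ lincomb d c′ b
  lincomb-cong zero c c′ b h = refl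
  lincomb-cong (suc d) c c′ b h =
    cong₂ _+_ (cong (λ z → ι z * b F.zero) (h F.zero)) (lincomb-cong d _ _ _ (h ∘ F.suc))

  lincomb-+ : ∀ d (c c′ : Fin d → Q.Carrier) b →
    lincomb d (λ i → c i Q.+ c′ i) b ≡ lincomb d c b + lincomb d c′ b
  lincomb-+ zero c c′ b = sym (+-identityˡ 0#)
  lincomb-+ (suc d) c c′ b =
    trans (cong₂ _+_ (trans (cong (_* b F.zero) (ι-+ _ _)) (distribʳ _ _ _)) (lincomb-+ d _ _ _))
          (interchange _ _ _ _)

  lincomb-neg : ∀ d (c : Fin d → Q.Carrier) b → lincomb d (λ i → Q.- c i) b ≡ - lincomb d c b
  lincomb-neg zero c b = sym -0#≈0#
  lincomb-neg (suc d) c b =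
    trans (cong₂ _+_ (trans (cong (_* b F.zero) (ι-neg _)) (sym (-‿distribˡ-* _ _))) (lincomb-neg d _ _))
          (-‿+-comm _ _)

  lincomb-zero : ∀ d b → lincomb d (λ _ → Q.0#) b ≡ 0#
  lincomb-zero zero b = refl
  lincomb-zero (suc d) b =
    trans (cong₂ _+_ (trans (cong (_* b F.zero) ι-0) (zeroˡ _)) (lincomb-zero d _)) (+-identityˡ 0#)

  lincomb-scalar : ∀ d a (c : Fin d → Q.Carrier) b → ι a * lincomb d c b ≡ lincomb d (λ i → a Q.* c i) b
  lincomb-scalar zero a c b = zeroʳ _
  lincomb-scalar (suc d) a c b =
    trans (distribˡ _ _ _)
          (cong₂ _+_ (trans (sym (*-assoc _ _ _)) (cong (_* b F.zero) (sym (ι-* _ _)))) (lincomb-scalar d a _ _))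

  lincomb-* : ∀ d β (c : Fin d → Q.Carrier) b → β * lincomb d c b ≡ lincomb d c (λ i → β * b i)
  lincomb-* zero β c b = zeroʳ _
  lincomb-* (suc d) β c b = trans (distribˡ _ _ _) (cong₂ _+_ (swap _ _ _) (lincomb-* d β _ _))
    where
    swap : ∀ a b c → a * (b * c) ≡ b * (a * c)
    swap a b c = trans (sym (*-assoc a b c)) (trans (cong (_* c) (*-comm a b)) (*-assoc b a c))

  module Basis {X : Sub} {d : ℕ} (hd : HasDim X d) where
    basis : Fin d → Carrier
    basis = proj₁ hd

    independent : LinIndep d basis
    independent = proj₁ (proj₂ hd)

    spans : ∀ x → X x → InSpan d basis x
    spans x = Equivalence.to (proj₂ (proj₂ hd) x)

    spanned : ∀ x → InSpan d basis x → X x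
    spanned x = Equivalence.from (proj₂ (proj₂ hd) x)

    ⟦_⟧ : Vec Q.Carrier d → Carrier
    ⟦ v ⟧ = lincomb d (lookup v) basis

    ⟦⟧-injective : ∀ v w → ⟦ v ⟧ ≡ ⟦ w ⟧ → v ≡ w
    ⟦⟧-injective v w h = trans (sym (VP.tabulate∘lookup v)) (trans (VP.tabulate-cong same) (VP.tabulate∘lookup w))
      where
      difference-zero : lincomb d (λ i → lookup v i Q.+ Q.- lookup w i) basis ≡ 0#
      difference-zero =
        trans (lincomb-+ d (lookup v) _ basis) (trans (cong (⟦ v ⟧ +_) (lincomb-neg d (lookup w) basis))
          (trans (cong (_+ - ⟦ w ⟧) h) (-‿inverseʳ _)))
      same : ∀ i → lookup v i ≡ lookup w i
      same i = Q.x∙y⁻¹≈ε⇒x≈y _ _ (independent _ difference-zero i)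

    ⟦⟧-member : ∀ v → X ⟦ v ⟧
    ⟦⟧-member v = spanned _ (lookup v , refl)

    coordinates : ∀ x → X x → Vec Q.Carrier d
    coordinates x h = tabulate (proj₁ (spans x h))

    ⟦coordinates⟧ : ∀ x (h : X x) → ⟦ coordinates x h ⟧ ≡ x
    ⟦coordinates⟧ x h = trans (lincomb-cong d _ _ basis (VP.lookup∘tabulate _)) (sym (proj₂ (spans x h)))

    origin : Vec Q.Carrier d
    origin = V.replicate d Q.0#

    ⟦origin⟧ : ⟦ origin ⟧ ≡ 0#
    ⟦origin⟧ = trans (lincomb-cong d _ _ basis (λ i → VP.lookup-replicate i Q.0#)) (lincomb-zero d basis)

    ⟦⟧-nonzero : ∀ v → ¬ v ≡ origin → ¬ ⟦ v ⟧ ≡ 0#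
    ⟦⟧-nonzero v nz h = nz (⟦⟧-injective v origin (trans h (sym ⟦origin⟧)))

    scalar-closed : ∀ a x → X x → X (ι a * x)
    scalar-closed a x h with spans x h
    ... | c , eq = spanned _ ((λ i → a Q.* c i) , trans (cong (ι a *_) eq) (lincomb-scalar d a c basis))

  scale-dim : ∀ {X d} β → ¬ β ≡ 0# → HasDim X d → HasDim (β · X) d
  scale-dim {X} {d} β nz hd =
    (λ i → β * basis i) , independent′ ,
    (λ y → record { to = to y ; from = from y ; to-cong = λ { refl → refl } ; from-cong = λ { refl → refl } })
    where
    open Basis hd
    independent′ : LinIndep d (λ i → β * basis i)
    independent′ c h = independent c (cancelˡ β nz (trans (lincomb-* d β c basis) (trans h (sym (zeroʳ β)))))
    to : ∀ y → (β · X) y → InSpan d (λ i → β * basis i) y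
    to y (x , hx , refl) with spans x hx
    ... | c , eq = c , trans (cong (β *_) eq) (lincomb-* d β c basis)
    from : ∀ y → InSpan d (λ i → β * basis i) y → (β · X) y
    from y (c , eq) = lincomb d c basis , spanned _ (c , refl) , trans eq (sym (lincomb-* d β c basis))

  ≐-refl : ∀ {A} → A ≐ A
  ≐-refl = (λ x h → h) , (λ x h → h)

  ≐-sym : ∀ {A B} → A ≐ B → B ≐ A
  ≐-sym (f , g) = g , f

  ≐-trans : ∀ {A B C} → A ≐ B → B ≐ C → A ≐ C
  ≐-trans (f , g) (f′ , g′) = (λ x h → f′ x (f x h)) , (λ x h → g x (g′ x h))

  ≐-setoid : Setoid (Level.suc Level.zero) Level.zero
  ≐-setoid = record
    { Carrier = Sub
    ; _≈_ = _≐_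
    ; isEquivalence = record { refl = ≐-refl ; sym = ≐-sym ; trans = ≐-trans }
    }

  ·-mono : ∀ β {A B} → A ⊆ B → (β · A) ⊆ (β · B)
  ·-mono β s y (x , h , e) = x , s x h , e

  ·-cong : ∀ β {A B} → A ≐ B → (β · A) ≐ (β · B)
  ·-cong β (f , g) = ·-mono β f , ·-mono β g

  ·-· : ∀ β γ A → (β · (γ · A)) ≐ ((β * γ) · A)
  ·-· β γ A = (λ { y (_ , (x , h , refl) , refl) → x , h , sym (*-assoc β γ x) })
            , (λ { y (x , h , refl) → γ * x , (x , h , refl) , *-assoc β γ x })

  ·-1 : ∀ A → (1# · A) ≐ A
  ·-1 A = (λ { y (x , h , refl) → subst A (sym (*-identityˡ x)) h }) , (λ y h → y , h , sym (*-identityˡ y))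

  module FiniteScalars (q : ℕ) (size : HasSize Fq q) where
    open VectorCount size using (encode; decode; decode-encode; vectors)

    -- if B ⊆ A then q^dim B ≤ q^dim A: coordinates in A give an injection
    dim-≤ : ∀ {A B a b} → HasDim A a → HasDim B b → B ⊆ A → q ℕ.^ b ≤ q ℕ.^ a
    dim-≤ {A} {B} {a} {b} hA hB B⊆A = FP.injective⇒≤ {f = code} code-injective
      where
      module A = Basis hA
      module B = Basis hB
      restrict : Vec Q.Carrier b → Vec Q.Carrier a
      restrict w = A.coordinates B.⟦ w ⟧ (B⊆A _ (B.⟦⟧-member w))
      ⟦restrict⟧ : ∀ w → A.⟦ restrict w ⟧ ≡ B.⟦ w ⟧
      ⟦restrict⟧ w = A.⟦coordinates⟧ _ (B⊆A _ (B.⟦⟧-member w))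
      code : Fin (q ℕ.^ b) → Fin (q ℕ.^ a)
      code i = encode (restrict (decode i))
      code-injective : ∀ {i j} → code i ≡ code j → i ≡ j
      code-injective {i} {j} e = begin
          i                            ≡⟨ sym (Inverse.strictlyInverseˡ (vectors b) i) ⟩
          encode (decode {b} i)        ≡⟨ cong encode same-vector ⟩
          encode (decode {b} j)        ≡⟨ Inverse.strictlyInverseˡ (vectors b) j ⟩
          j                            ∎
        where
        open ≡-Reasoning
        same-restriction : restrict (decode i) ≡ restrict (decode j)
        same-restriction = trans (sym (decode-encode _)) (trans (cong decode e) (decode-encode _))
        same-vector : decode {b} i ≡ decode j
        same-vector = B.⟦⟧-injective _ _
          (trans (sym (⟦restrict⟧ (decode i))) (trans (cong A.⟦_⟧ same-restriction) (⟦restrict⟧ (decode j))))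

    dim-unique : 2 ≤ q → ∀ {A B d} → HasDim A d → HasDim B (suc d) → A ≐ B → ⊥
    dim-unique q≥2 {d = d} hA hB (A⊆B , B⊆A) = ℕP.<⇒≱ growth (dim-≤ hA hB B⊆A)
      where
      growth : q ℕ.^ d < q ℕ.^ suc d
      growth = subst (_< q ℕ.^ suc d) (ℕP.*-identityˡ _)
        (ℕP.*-monoˡ-< (q ℕ.^ d) ⦃ ℕ.>-nonZero (ℕP.m^n>0 q ⦃ ℕ.>-nonZero (ℕP.<-trans (s≤s z≤n) q≥2) ⦄ d) ⦄ {1} {q} q≥2)

    -- if β has order M and stabilises X then M divides |X| - 1 = q^dim X - 1:
    -- multiplication by β permutes the nonzero coordinate vectors of X freely
    stabiliser-order : ∀ {X d β M} → HasDim X d → HasOrder β M → (∀ x → X x → X (β * x)) →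
      M ∣ q ℕ.^ d ∸ 1
    stabiliser-order {X} {d} {β} {suc M′} hd ord stable =
      period-divides (vectors d) act M′ origin periodic keep free
      where
      open Basis hd
      open HasOrder ord
      act : Vec Q.Carrier d → Vec Q.Carrier d
      act v = coordinates (β * ⟦ v ⟧) (stable _ (⟦⟧-member v))
      ⟦iter⟧ : ∀ j v → ⟦ iter act j v ⟧ ≡ β ^ᴺ j * ⟦ v ⟧
      ⟦iter⟧ zero v = sym (*-identityˡ _)
      ⟦iter⟧ (suc j) v = trans (⟦coordinates⟧ _ (stable _ (⟦⟧-member (iter act j v))))
                               (trans (cong (β *_) (⟦iter⟧ j v)) (sym (*-assoc _ _ _)))
      β≢0 : ¬ β ≡ 0#
      β≢0 β0 = 1≢0 (trans (sym returns) (trans (cong (_^ᴺ suc M′) β0) (zeroˡ _)))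
      periodic : ∀ v → iter act (suc M′) v ≡ v
      periodic v = ⟦⟧-injective _ _ (trans (⟦iter⟧ (suc M′) v) (trans (cong (_* ⟦ v ⟧) returns) (*-identityˡ _)))
      keep : ∀ v → ¬ v ≡ origin → ¬ act v ≡ origin
      keep v nz e = *-nonzero β≢0 (⟦⟧-nonzero v nz)
        (trans (sym (⟦coordinates⟧ _ (stable _ (⟦⟧-member v)))) (trans (cong ⟦_⟧ e) ⟦origin⟧))
      free : ∀ v → ¬ v ≡ origin → ∀ j → 0 < j → j < suc M′ → ¬ iter act j v ≡ v
      free v nz j j>0 j<M e = minimal j j>0 j<M
        (cancelʳ ⟦ v ⟧ (⟦⟧-nonzero v nz) (trans (sym (⟦iter⟧ j v)) (trans (cong ⟦_⟧ e) (sym (*-identityˡ _)))))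

-- The closed walk X₁ Y₁ X₂ Y₂ … X_t Y_t, repeated lap after lap.  Position p of the
-- walk is the stop  (lap j, index i, top b)  with  p = j·2t + 2i + b.
module Walk (t′ : ℕ) where

  open Counting using ([_]⁰¹)
  open import Data.Nat as ℕ using (zero; suc; _+_; _*_; _∸_; _≤_; _<_; z≤n; s≤s)
  open import Data.Nat.Properties
  open import Data.Nat.DivMod using (_%_; [m+kn]%n≡m%n; m<n⇒m%n≡m)
  open import Data.Nat.Tactic.RingSolver using (solve-∀)
  open import Data.Bool using (Bool; true; false)
  open import Data.Product using (_×_; _,_)
  open import Relation.Nullary using (yes; no)
  open import Relation.Binary.PropositionalEquality

  t : ℕ
  t = suc t′

  record Stop : Set where
    constructor ⟨_,_,_⟩
    field
      lap index : ℕ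
      top : Bool
  open Stop

  next : Stop → Stop
  next ⟨ j , i , false ⟩ = ⟨ j , i , true ⟩
  next ⟨ j , i , true ⟩ with suc i ≟ t
  ... | yes _ = ⟨ suc j , 0 , false ⟩
  ... | no _ = ⟨ j , suc i , false ⟩

  stop : ℕ → Stop
  stop zero = ⟨ 0 , 0 , false ⟩
  stop (suc p) = next (stop p)

  Valid : Stop → Set
  Valid s = index s < t

  offset : Stop → ℕ
  offset s = 2 * index s + [ top s ]⁰¹

  rank : Stop → ℕ
  rank s = lap s * (2 * t) + offset s

  offset< : ∀ s → Valid s → offset s < 2 * t
  offset< ⟨ j , i , b ⟩ i<t =
    ≤-trans (s≤s (+-monoʳ-≤ (2 * i) (bit≤1 b))) (≤-trans (≤-reflexive (double i)) (*-monoʳ-≤ 2 i<t))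
    where
    double : ∀ i → suc (2 * i + 1) ≡ 2 * suc i
    double = solve-∀
    bit≤1 : ∀ b → [ b ]⁰¹ ≤ 1
    bit≤1 true = s≤s z≤n
    bit≤1 false = z≤n

  next-valid : ∀ s → Valid s → Valid (next s)
  next-valid ⟨ j , i , false ⟩ i<t = i<t
  next-valid ⟨ j , i , true ⟩ i<t with suc i ≟ t
  ... | yes _ = s≤s z≤n
  ... | no ne = ≤∧≢⇒< i<t ne

  rank-next : ∀ s → Valid s → rank (next s) ≡ suc (rank s)
  rank-next ⟨ j , i , false ⟩ _ = same-index j i (2 * t)
    where
    same-index : ∀ j i T → j * T + (2 * i + 1) ≡ suc (j * T + (2 * i + 0))
    same-index = solve-∀
  rank-next ⟨ j , i , true ⟩ _ with suc i ≟ t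
  ... | yes refl = new-lap j i
    where
    new-lap : ∀ j i → suc j * (2 * suc i) + (2 * 0 + 0) ≡ suc (j * (2 * suc i) + (2 * i + 1))
    new-lap = solve-∀
  ... | no _ = next-index j i (2 * t)
    where
    next-index : ∀ j i T → j * T + (2 * suc i + 0) ≡ suc (j * T + (2 * i + 1))
    next-index = solve-∀

  stop-valid : ∀ p → Valid (stop p)
  stop-valid zero = s≤s z≤n
  stop-valid (suc p) = next-valid (stop p) (stop-valid p)

  rank-stop : ∀ p → rank (stop p) ≡ p
  rank-stop zero = refl
  rank-stop (suc p) = trans (rank-next (stop p) (stop-valid p)) (cong suc (rank-stop p))

  quotient-remainder-unique : ∀ m j j′ r r′ → r < m → r′ < m → j * m + r ≡ j′ * m + r′ → j ≡ j′ × r ≡ r′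
  quotient-remainder-unique m@(suc _) j j′ r r′ r<m r′<m e = quotients , remainders
    where
    remainders : r ≡ r′
    remainders = begin
        r                  ≡⟨ sym (m<n⇒m%n≡m r<m) ⟩
        r % m              ≡⟨ sym ([m+kn]%n≡m%n r j m) ⟩
        (r + j * m) % m    ≡⟨ cong (_% m) (trans (+-comm r _) (trans e (+-comm _ r′))) ⟩
        (r′ + j′ * m) % m  ≡⟨ [m+kn]%n≡m%n r′ j′ m ⟩
        r′ % m             ≡⟨ m<n⇒m%n≡m r′<m ⟩
        r′                 ∎
      where open ≡-Reasoning
    quotients : j ≡ j′
    quotients = *-cancelʳ-≡ j j′ m (+-cancelʳ-≡ _ _ _ (trans e (cong (j′ * m +_) (sym remainders))))

  rank-injective : ∀ s s′ → Valid s → Valid s′ → rank s ≡ rank s′ → s ≡ s′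
  rank-injective ⟨ j , i , b ⟩ ⟨ j′ , i′ , b′ ⟩ v v′ e
    with quotient-remainder-unique (2 * t) j j′ _ _ (offset< ⟨ j , i , b ⟩ v) (offset< ⟨ j′ , i′ , b′ ⟩ v′) e
  ... | refl , e₂ with quotient-remainder-unique 2 i i′ [ b ]⁰¹ [ b′ ]⁰¹ (bit<2 b) (bit<2 b′)
                         (trans (cong (_+ [ b ]⁰¹) (*-comm i 2)) (trans e₂ (cong (_+ [ b′ ]⁰¹) (*-comm 2 i′))))
    where
    bit<2 : ∀ b → [ b ]⁰¹ < 2
    bit<2 true = s≤s (s≤s z≤n)
    bit<2 false = s≤s z≤n
  ... | refl , e₃ = cong ⟨ j , i ,_⟩ (bit-injective b b′ e₃)
    where
    bit-injective : ∀ b b′ → [ b ]⁰¹ ≡ [ b′ ]⁰¹ → b ≡ b′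
    bit-injective true true _ = refl
    bit-injective false false _ = refl

  lap< : ∀ N s → rank s < N * (2 * t) → lap s < N
  lap< N ⟨ j , i , b ⟩ lt = *-cancelʳ-< (2 * t) j N (≤-<-trans (m≤m+n _ _) lt)

  last-stop : ∀ N′ → stop (2 * t * suc N′ ∸ 1) ≡ ⟨ N′ , t′ , true ⟩
  last-stop N′ = rank-injective _ _ (stop-valid (2 * t * suc N′ ∸ 1)) (n<1+n t′) (trans (rank-stop _) (cong (_∸ 1) (length t′ N′)))
    where
    length : ∀ t′ N′ → 2 * suc t′ * suc N′ ≡ suc (N′ * (2 * suc t′) + (2 * t′ + 1))
    length = solve-∀

-- Setting of the theorem: Fq has q = q₂ + 2 elements, K = Fq^n with n = 2k+1,
-- and α is a primitive element of K, of order Q₁ = q^n - 1 = (q - 1)·N.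
module PrimitiveElement (q₂ k : ℕ) (k≥1 : 1 ≤ k) {Fq K : Field}
  (sizeQ : HasSize Fq (suc (suc q₂))) (sizeK : HasSize K (suc (suc q₂) ℕ.^ (2 ℕ.* k ℕ.+ 1)))
  (E : Embedding Fq K) (α : Field.Carrier K) (prim : Primitive K α) where

  open NatFacts
  open Counting
  open import Data.Nat as ℕ using (zero; _<_; _∸_; z≤n; s≤s)
  import Data.Nat.Properties as ℕP
  open import Data.Nat.Divisibility as ND using (_∣_; divides; ∣⇒≤; *-cancelʳ-∣; ∣m+n∣m⇒∣n; ∣n⇒∣m*n; ∣m⇒∣m*n)
  open import Data.Nat.DivMod using (_%_; m%n<n)
  open import Data.Nat.Tactic.RingSolver using (solve-∀)
  open import Data.Nat.GCD using (gcd; gcd[m,n]∣m; gcd[m,n]∣n; gcd-GCD; module Bézout)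
  open import Data.Nat.Coprimality using (gcd≡1⇒coprime; coprime-divisor)
  import Data.Nat.Coprimality as Coprimality
  open import Data.Integer using (ℤ; +_; -[1+_]; ∣_∣)
  open import Data.Fin as F using (Fin; toℕ; fromℕ<)
  import Data.Fin.Properties as FP
  open import Data.Bool using (Bool; true; false; _∧_)
  open import Data.Bool.Properties using (∧-zeroʳ; ∧-conicalˡ; ∧-conicalʳ)
  open import Data.Product using (Σ; _,_; proj₁; proj₂)
  open import Data.Sum using (_⊎_; inj₁; inj₂)
  open import Relation.Nullary using (¬_)
  open import Relation.Binary.PropositionalEquality
  open import Function.Bundles using (Inverse)

  open Embedding E using (ι; ι-*; ι-1; ι-inj)
  open FieldFacts K public
  open Linear E public
  open FiniteScalars (suc (suc q₂)) sizeQ public using (dim-unique; stabiliser-order)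
  open PowersOf (suc q₂) public using (q; geometric; geometric-sum; geometric≥2; common-divisor-of-k; common-divisor-of-suc-k)
  module K↔ = Inverse sizeK
  module Q↔ = Inverse sizeQ

  q₁ : ℕ
  q₁ = suc q₂

  n : ℕ
  n = 2 ℕ.* k ℕ.+ 1

  N : ℕ
  N = geometric n

  Q₁ : ℕ
  Q₁ = N ℕ.* q₁

  module KF = Finite (q ℕ.^ n) sizeK
  module QF = Q.Finite q sizeQ

  q^n≡ : q ℕ.^ n ≡ suc Q₁
  q^n≡ = trans (sym (geometric-sum n)) (cong suc (ℕP.*-comm q₁ N))

  gauss≡N : gauss q n ≡ N
  gauss≡N = gauss-geometric q₂ n

  N≥2 : 2 ≤ N
  N≥2 = geometric≥2 n (ℕP.≤-trans (s≤s (s≤s z≤n)) (ℕP.+-monoˡ-≤ 1 (ℕP.*-monoʳ-≤ 2 k≥1)))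

  N>0 : 0 < N
  N>0 = ℕP.<-trans (s≤s z≤n) N≥2

  Q₁≥2 : 2 ≤ Q₁
  Q₁≥2 = ℕP.≤-trans N≥2 (ℕP.m≤m*n N q₁)

  α≢0 : ¬ α ≡ 0#
  α≢0 = KF.primitive-nonzero (subst (3 ≤_) (sym q^n≡) (s≤s Q₁≥2)) α prim

  α-order : HasOrder α Q₁
  α-order = subst (HasOrder α) (cong (_∸ 1) q^n≡) (KF.primitive-order α prim α≢0)

  α^Q₁* : ∀ j → α ^ᴺ (Q₁ ℕ.* j) ≡ 1#
  α^Q₁* = ^-1-multiple α Q₁ (HasOrder.returns α-order)

  β : Carrier
  β = α ^ᴺ N

  β-order : HasOrder β q₁
  β-order = order-of-power α-order N q₁ (s≤s z≤n) refl

  private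
    -- every nonzero scalar is a power of β, by Fermat's little theorem in Fq
    scalar-power : ∀ a → ¬ a ≡ Q.0# → Σ ℕ λ u → ι a ≡ β ^ᴺ u
    scalar-power a nz = ND.quotient N∣m , trans ιa≡ (trans (cong (α ^ᴺ_) m≡) (^-* α N _))
      where
      m = proj₁ (prim (ι a) (ι-nonzero a nz))
      ιa≡ : ι a ≡ α ^ᴺ m
      ιa≡ = proj₂ (prim (ι a) (ι-nonzero a nz))
      α^mq₁≡1 : α ^ᴺ (m ℕ.* q₁) ≡ 1#
      α^mq₁≡1 = trans (^-* α m q₁) (trans (cong (_^ᴺ q₁) (sym ιa≡))
                  (trans (sym (ι-^ a q₁)) (trans (cong ι (QF.fermat a nz)) ι-1)))
      N∣m : N ∣ m
      N∣m = *-cancelʳ-∣ {N} {m} q₁ (order-divides α-order (m ℕ.* q₁) α^mq₁≡1)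
      m≡ : m ≡ N ℕ.* ND.quotient N∣m
      m≡ = trans (ND._∣_.equality N∣m) (ℕP.*-comm _ N)

    powers : Fin q₁ → Fin (q ℕ.^ n)
    powers j = K↔.to (β ^ᴺ suc (toℕ j))

    powers-injective : ∀ i j → powers i ≡ powers j → i ≡ j
    powers-injective = injective-by-order powers λ {i} {j} lt e →
      distinct lt (FP.toℕ<n j) (↔-injective sizeK e)
      where
      distinct : ∀ {a b} → a < b → b < q₁ → ¬ β ^ᴺ suc a ≡ β ^ᴺ suc b
      distinct {a} {b} a<b b<q₁ e = HasOrder.minimal β-order (b ∸ a) (ℕP.m<n⇒0<n∸m a<b)
        (ℕP.≤-<-trans (ℕP.m∸n≤m b a) b<q₁) (^-difference β (^-nonzero α N α≢0) (s≤s (ℕP.<⇒≤ a<b)) e)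

    scalars : Fin q → Fin (q ℕ.^ n)
    scalars j = K↔.to (ι (Q↔.from j))

    nonzero-scalar : Fin (q ℕ.^ n) → Bool
    nonzero-scalar i = image scalars i ∧ KF.nonzero i

    count-nonzero-scalars : count nonzero-scalar ≡ q₁
    count-nonzero-scalars = ℕP.+-cancelˡ-≡ 1 _ _ (begin
        1 ℕ.+ count nonzero-scalar
      ≡⟨ cong (ℕ._+ count nonzero-scalar) (sym (trans (count-cong _ _ zero-scalar) (count-singleton (K↔.to 0#)))) ⟩
        count (λ i → image scalars i ∧ (i == K↔.to 0#)) ℕ.+ count nonzero-scalar
      ≡⟨ sym (count-split (image scalars) (_== K↔.to 0#)) ⟩
        count (image scalars)
      ≡⟨ count-image-injective scalars (λ i j e → ↔-from-injective sizeQ (ι-inj _ _ (↔-injective sizeK e))) ⟩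
        q ∎)
      where
      open ≡-Reasoning
      zero-in : image scalars (K↔.to 0#) ≡ true
      zero-in = subst (λ w → image scalars w ≡ true) (cong K↔.to (trans (cong ι (Q↔.strictlyInverseʳ Q.0#)) ι-0))
                  (image-intro scalars (Q↔.to Q.0#))
      zero-scalar : ∀ i → (image scalars i ∧ (i == K↔.to 0#)) ≡ (i == K↔.to 0#)
      zero-scalar i with i == K↔.to 0# in eq
      ... | false = ∧-zeroʳ _
      ... | true rewrite ==-sound eq | zero-in = refl

    -- every power β^r, r < q - 1, is among β¹, …, β^(q-1) (note β^0 = β^(q-1))
    power-listed : ∀ r → r < q₁ → image powers (K↔.to (β ^ᴺ r)) ≡ true
    power-listed zero _ =
      subst (λ z → image powers (K↔.to z) ≡ true) (HasOrder.returns β-order)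
        (subst (λ z → image powers (K↔.to (β ^ᴺ suc z)) ≡ true) (FP.toℕ-fromℕ< (ℕP.n<1+n q₂))
          (image-intro powers (fromℕ< (ℕP.n<1+n q₂))))
    power-listed (suc r) r<q₁ =
      subst (λ z → image powers (K↔.to (β ^ᴺ suc z)) ≡ true) (FP.toℕ-fromℕ< r′<q₁)
        (image-intro powers (fromℕ< r′<q₁))
      where
      r′<q₁ = ℕP.<-trans (ℕP.n<1+n r) r<q₁

    scalars-are-powers : ∀ i → nonzero-scalar i ≡ true → image powers i ≡ true
    scalars-are-powers i h = subst (λ w → image powers w ≡ true) listed≡i (power-listed (u % q₁) (m%n<n u q₁))
      where
      found = image-elim scalars i (∧-conicalˡ _ _ h)
      a = Q↔.from (proj₁ found)
      a≢0 : ¬ a ≡ Q.0#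
      a≢0 z = KF.nonzero-sound i (∧-conicalʳ _ _ h)
                (trans (cong K↔.from (sym (proj₂ found))) (trans (K↔.strictlyInverseʳ _) (trans (cong ι z) ι-0)))
      u = proj₁ (scalar-power a a≢0)
      listed≡i : K↔.to (β ^ᴺ (u % q₁)) ≡ i
      listed≡i = trans (cong K↔.to (sym (trans (proj₂ (scalar-power a a≢0)) (^-mod β-order u)))) (proj₂ found)

  -- β = α^N is a scalar: by counting, the q - 1 distinct powers of β are the q - 1 nonzero scalars
  β-scalar : Σ Q.Carrier λ c₀ → ι c₀ ≡ β
  β-scalar = Q↔.from (proj₁ found) , trans (↔-injective sizeK (proj₂ found)) (*-identityʳ β)
    where
    β-listed : nonzero-scalar (powers F.zero) ≡ true
    β-listed = ⊆-by-count nonzero-scalar (image powers) scalars-are-powers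
      (ℕP.≤-reflexive (trans (count-image-injective powers powers-injective) (sym count-nonzero-scalars)))
      (powers F.zero) (image-intro powers F.zero)
    found = image-elim scalars (powers F.zero) (∧-conicalˡ _ _ β-listed)

  c₀ : Q.Carrier
  c₀ = proj₁ β-scalar

  α^N*≡ι : ∀ y → α ^ᴺ (N ℕ.* y) ≡ ι (c₀ Q.^ᴺ y)
  α^N*≡ι y = trans (^-* α N y) (trans (cong (_^ᴺ y) (sym (proj₂ β-scalar))) (sym (ι-^ c₀ y)))

  Q₁-pred : suc (Q₁ ∸ 1) ≡ Q₁
  Q₁-pred = ℕP.m+[n∸m]≡n {1} (ℕP.<-trans (s≤s z≤n) Q₁≥2)

  α^Q₁*+ : ∀ j a → α ^ᴺ (Q₁ ℕ.* j ℕ.+ a) ≡ α ^ᴺ a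
  α^Q₁*+ j a = trans (^-+ α (Q₁ ℕ.* j) a) (trans (cong (_* α ^ᴺ a) (α^Q₁* j)) (*-identityˡ _))

  -- (Q₁ - 1)·b is an exponent inverting b
  inverse-exponent : ∀ a b → (Q₁ ∸ 1) ℕ.* b ℕ.+ (b ℕ.+ a) ≡ Q₁ ℕ.* b ℕ.+ a
  inverse-exponent a b = trans (identity (Q₁ ∸ 1) a b) (cong (λ z → z ℕ.* b ℕ.+ a) Q₁-pred)
    where
    identity : ∀ P a b → P ℕ.* b ℕ.+ (b ℕ.+ a) ≡ suc P ℕ.* b ℕ.+ a
    identity = solve-∀

  record Stable (X : Sub) (e : ℕ) : Set where
    constructor stable
    field apply : ∀ x → X x → X (α ^ᴺ e * x)
  open Stable

  stable-+ : ∀ {X a b} → Stable X a → Stable X b → Stable X (a ℕ.+ b)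
  stable-+ {X} {a} {b} sa sb = stable λ x h →
    subst X (trans (sym (*-assoc _ _ x)) (cong (_* x) (sym (^-+ α a b)))) (apply sa _ (apply sb x h))

  stable-* : ∀ {X e} → Stable X e → ∀ m → Stable X (m ℕ.* e)
  stable-* {X} se zero = stable λ x h → subst X (sym (*-identityˡ x)) h
  stable-* se (suc m) = stable-+ se (stable-* se m)

  -- multiples of N act as the nonzero scalars c₀^y
  stable-N : ∀ {X d} → HasDim X d → ∀ y → Stable X (N ℕ.* y)
  stable-N {X} hd y = stable λ x h → subst X (cong (_* x) (sym (α^N*≡ι y))) (Basis.scalar-closed hd _ x h)

  -- since α^Q₁ = 1, stability under b + a and under b give stability under a
  stable-cancel : ∀ {X} a b → Stable X (b ℕ.+ a) → Stable X b → Stable X a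
  stable-cancel {X} a b sba sb = stable λ x h → subst X (cong (_* x) (α^Q₁*+ b a))
    (subst (λ z → X (α ^ᴺ z * x)) (inverse-exponent a b) (apply (stable-+ (stable-* sb (Q₁ ∸ 1)) sba) x h))

  -- by Bézout, stability under α^e gives stability under α^gcd(e,N)
  stable-gcd : ∀ {X d} → HasDim X d → ∀ {e} → Stable X e → Stable X (gcd e N)
  stable-gcd {X} hd {e} se with Bézout.identity (gcd-GCD e N)
  ... | Bézout.+- u y eq = stable-cancel (gcd e N) (y ℕ.* N)
          (subst (Stable X) (trans (sym eq) (ℕP.+-comm _ (y ℕ.* N))) (stable-* se u))
          (subst (Stable X) (ℕP.*-comm N y) (stable-N hd y))
  ... | Bézout.-+ u y eq = stable-cancel (gcd e N) (u ℕ.* e)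
          (subst (Stable X) (trans (ℕP.*-comm N y) (trans (sym eq) (ℕP.+-comm (gcd e N) _))) (stable-N hd y))
          (stable-* se u)

  -- If α^s (s = gcd(e,N), N = r·s) stabilises X, its order q₁·r divides both q^d - 1 and
  -- q^n - 1, hence divides q - 1, so r = 1.
  stabiliser : ∀ {X d} → HasDim X d → d ≡ k ⊎ d ≡ suc k → ∀ {e} → Stable X e → N ∣ e
  stabiliser {X} {d} hd d∈ {e} se with gcd[m,n]∣n e N
  ... | divides r N≡rs = subst (_∣ e) s≡N (gcd[m,n]∣m e N)
    where
    s = gcd e N
    s*q₁r≡Q₁ : s ℕ.* (q₁ ℕ.* r) ≡ Q₁
    s*q₁r≡Q₁ = trans (rearrange s q₁ r) (cong (ℕ._* q₁) (sym N≡rs))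
      where
      rearrange : ∀ s q r → s ℕ.* (q ℕ.* r) ≡ r ℕ.* s ℕ.* q
      rearrange = solve-∀
    r≢0 : ¬ r ≡ 0
    r≢0 refl = ℕP.<⇒≢ N>0 (sym N≡rs)
    ord : HasOrder (α ^ᴺ s) (q₁ ℕ.* r)
    ord = order-of-power α-order s (q₁ ℕ.* r) (ℕP.*-mono-< {0} {q₁} {0} {r} (s≤s z≤n) (ℕP.n≢0⇒n>0 r≢0)) s*q₁r≡Q₁
    divides-q^d : q₁ ℕ.* r ∣ q ℕ.^ d ∸ 1
    divides-q^d = stabiliser-order hd ord (apply (stable-gcd hd se))
    divides-q^n : q₁ ℕ.* r ∣ q ℕ.^ n ∸ 1
    divides-q^n = divides s (trans (cong (_∸ 1) q^n≡) (sym s*q₁r≡Q₁))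
    divides-q₁ : q₁ ℕ.* r ∣ q₁
    divides-q₁ = common-divisor d∈ divides-q^d
      where
      common-divisor : d ≡ k ⊎ d ≡ suc k → q₁ ℕ.* r ∣ q ℕ.^ d ∸ 1 → q₁ ℕ.* r ∣ q₁
      common-divisor (inj₁ refl) h = common-divisor-of-k k _ h divides-q^n
      common-divisor (inj₂ refl) h = common-divisor-of-suc-k k _ h divides-q^n
    r≡1 : r ≡ 1
    r≡1 = ℕP.≤-antisym (ℕP.*-cancelˡ-≤ q₁ (ℕP.≤-trans (∣⇒≤ divides-q₁) (ℕP.≤-reflexive (sym (ℕP.*-identityʳ q₁)))))
                       (ℕP.n≢0⇒n>0 r≢0)
    s≡N : s ≡ N
    s≡N = sym (trans N≡rs (trans (cong (ℕ._* s) r≡1) (ℕP.*-identityˡ s)))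

  -- integer exponents: α^z = α^(ν z) for a natural number ν z
  ν : ℤ → ℕ
  ν (+ m) = m
  ν -[1+ m ] = (Q₁ ∸ 1) ℕ.* suc m

  α⁻¹≡ : α ⁻¹ ≡ α ^ᴺ (Q₁ ∸ 1)
  α⁻¹≡ = cancelˡ α α≢0 (trans (inverseʳ α α≢0)
           (sym (trans (cong (α ^ᴺ_) Q₁-pred) (HasOrder.returns α-order))))

  ^ᶻ≡^ν : ∀ z → α ^ᶻ z ≡ α ^ᴺ ν z
  ^ᶻ≡^ν (+ m) = refl
  ^ᶻ≡^ν -[1+ m ] = trans (cong (_^ᴺ suc m) α⁻¹≡) (sym (^-* α (Q₁ ∸ 1) (suc m)))

  -- if z is coprime to N then so is ν z, because Q₁ - 1 ≡ -1 modulo N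
  ν-cancel : ∀ z → gcd ∣ z ∣ N ≡ 1 → ∀ δ → N ∣ δ ℕ.* ν z → N ∣ δ
  ν-cancel z coprime δ h =
    coprime-divisor {N} {∣ z ∣} (Coprimality.sym (gcd≡1⇒coprime {∣ z ∣} {N} coprime)) (subst (N ∣_) (ℕP.*-comm δ ∣ z ∣) (absolute z h))
    where
    absolute : ∀ z → N ∣ δ ℕ.* ν z → N ∣ δ ℕ.* ∣ z ∣
    absolute (+ m) h = h
    absolute -[1+ m ] h = ∣m+n∣m⇒∣n (subst (N ∣_) split (∣n⇒∣m*n δ (∣m⇒∣m*n (suc m) (ND.∣m⇒∣m*n q₁ ND.∣-refl)))) h
      where
      split : δ ℕ.* (Q₁ ℕ.* suc m) ≡ δ ℕ.* ((Q₁ ∸ 1) ℕ.* suc m) ℕ.+ δ ℕ.* suc m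
      split = trans (cong (λ z → δ ℕ.* (z ℕ.* suc m)) (sym Q₁-pred))
                (trans (cong (δ ℕ.*_) (ℕP.+-comm (suc m) _)) (ℕP.*-distribˡ-+ δ _ _))

  ·-^ : ∀ a b A → ((α ^ᴺ a) · ((α ^ᴺ b) · A)) ≐ ((α ^ᴺ (a ℕ.+ b)) · A)
  ·-^ a b A = subst (λ z → ((α ^ᴺ a) · ((α ^ᴺ b) · A)) ≐ (z · A)) (sym (^-+ α a b)) (·-· _ _ A)

  ·-^Q₁* : ∀ j A → ((α ^ᴺ (Q₁ ℕ.* j)) · A) ≐ A
  ·-^Q₁* j A = subst (λ z → (z · A) ≐ A) (sym (α^Q₁* j)) (·-1 A)

  -- α^a A = α^b B  means  B = α^(a - b) A, with exponents read modulo Q₁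
  rescale : ∀ a b A B → ((α ^ᴺ a) · A) ≐ ((α ^ᴺ b) · B) → B ≐ ((α ^ᴺ ((Q₁ ∸ 1) ℕ.* b ℕ.+ a)) · A)
  rescale a b A B h = begin
      B                                                  ≈⟨ ≐-sym (·-^Q₁* b B) ⟩
      (α ^ᴺ (Q₁ ℕ.* b)) · B                              ≡⟨ cong (λ z → (α ^ᴺ z) · B) (sym (trans (inverse-exponent 0 b) (ℕP.+-identityʳ _))) ⟩
      (α ^ᴺ (c ℕ.+ (b ℕ.+ 0))) · B                        ≈⟨ ≐-sym (·-^ c (b ℕ.+ 0) B) ⟩
      (α ^ᴺ c) · ((α ^ᴺ (b ℕ.+ 0)) · B)                   ≡⟨ cong (λ z → (α ^ᴺ c) · ((α ^ᴺ z) · B)) (ℕP.+-identityʳ b) ⟩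
      (α ^ᴺ c) · ((α ^ᴺ b) · B)                          ≈⟨ ·-cong (α ^ᴺ c) (≐-sym h) ⟩
      (α ^ᴺ c) · ((α ^ᴺ a) · A)                          ≈⟨ ·-^ c a A ⟩
      (α ^ᴺ (c ℕ.+ a)) · A                               ∎
    where
    open import Relation.Binary.Reasoning.Setoid ≐-setoid
    c = (Q₁ ∸ 1) ℕ.* b

  translate-stable : ∀ a b {A} → ((α ^ᴺ (a ℕ.+ b)) · A) ⊆ ((α ^ᴺ a) · A) → Stable A b
  translate-stable a b {A} h = stable λ x hx → moved x hx (h _ (x , hx , refl))
    where
    moved : ∀ x → A x → ((α ^ᴺ a) · A) (α ^ᴺ (a ℕ.+ b) * x) → A (α ^ᴺ b * x)
    moved x hx (y , hy , e) = subst A (cancelˡ (α ^ᴺ a) (^-nonzero α a α≢0) (trans (sym e) (trans (cong (_* x) (^-+ α a b)) (*-assoc _ _ _)))) hy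

  scalar-absorb : ∀ {A d} → HasDim A d → ∀ y → A ⊆ ((α ^ᴺ (N ℕ.* y)) · A)
  scalar-absorb {A} hd y x hx = ι (c Q.⁻¹) * x , Basis.scalar-closed hd (c Q.⁻¹) x hx , sym undo
    where
    c = c₀ Q.^ᴺ y
    c≢0 : ¬ c ≡ Q.0#
    c≢0 = Q.^-nonzero c₀ y λ z → ^-nonzero α N α≢0 (trans (sym (proj₂ β-scalar)) (trans (cong ι z) ι-0))
    undo : α ^ᴺ (N ℕ.* y) * (ι (c Q.⁻¹) * x) ≡ x
    undo = begin
        α ^ᴺ (N ℕ.* y) * (ι (c Q.⁻¹) * x)    ≡⟨ cong (_* (ι (c Q.⁻¹) * x)) (α^N*≡ι y) ⟩
        ι c * (ι (c Q.⁻¹) * x)               ≡⟨ sym (*-assoc _ _ x) ⟩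
        (ι c * ι (c Q.⁻¹)) * x               ≡⟨ cong (_* x) (trans (sym (ι-* c _)) (trans (cong ι (Q.inverseʳ c c≢0)) ι-1)) ⟩
        1# * x                               ≡⟨ *-identityˡ x ⟩
        x                                    ∎
      where open ≡-Reasoning

module Cycle (q₂ k : ℕ) (k≥1 : 1 ≤ k) {Fq K : Field}
  (sizeQ : HasSize Fq (suc (suc q₂))) (sizeK : HasSize K (suc (suc q₂) ℕ.^ (2 ℕ.* k ℕ.+ 1)))
  (E : Embedding Fq K) (α : Field.Carrier K) (prim : Primitive K α)
  (t′ : ℕ) (X Y : ℕ → VectorSpace.Sub E)
  (dim-X : ∀ i → i < suc t′ → VectorSpace.HasDim E (X i) k)
  (dim-Y : ∀ i → i < suc t′ → VectorSpace.HasDim E (Y i) (suc k))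
  (inequivalent : ∀ i j → i < suc t′ → j < suc t′ → ¬ (i ≡ j) →
    ¬ VectorSpace.Erel E α (X i) (X j) × ¬ VectorSpace.Erel E α (Y i) (Y j))
  (X⊆Y : ∀ i → i < suc t′ → VectorSpace._⊆_ E (X i) (Y i))
  (X⊆Y-previous : ∀ i → suc i < suc t′ → VectorSpace._⊆_ E (X (suc i)) (Y i))
  (ℓ : ℤ) (closing : VectorSpace._⊆_ E (VectorSpace._·_ E (Field._^ᶻ_ K α ℓ) (X 0)) (Y t′))
  (coprime : gcd ∣ ℓ ∣ (gauss (suc (suc q₂)) (2 ℕ.* k ℕ.+ 1)) ≡ 1) where

  open PrimitiveElement q₂ k k≥1 sizeQ sizeK E α prim
  open Walk t′
  open import Data.Nat as ℕ using (_∸_; z≤n; s≤s)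
  import Data.Nat.Properties as ℕP
  open import Data.Nat.Divisibility using (_∣_; ∣⇒≤)
  open import Data.Bool using (true; false)
  open import Data.Product using (_,_; proj₁; proj₂)
  open import Data.Sum using (_⊎_; inj₁; inj₂)
  open import Data.Empty using (⊥-elim)
  open import Relation.Nullary using (yes; no)
  open import Relation.Binary.PropositionalEquality
  open import Relation.Binary.Definitions using (tri<; tri≈; tri>)
  open import Function using (_∘_)

  L : ℕ
  L = ν ℓ

  ℓ-coprime-N : gcd ∣ ℓ ∣ N ≡ 1
  ℓ-coprime-N = subst (λ z → gcd ∣ ℓ ∣ z ≡ 1) gauss≡N coprime

  α^L·X₀⊆Y : ((α ^ᴺ L) · X 0) ⊆ Y t′
  α^L·X₀⊆Y = subst (λ z → (z · X 0) ⊆ Y t′) (^ᶻ≡^ν ℓ) closing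

  vertex : Stop → Sub
  vertex ⟨ j , i , false ⟩ = (α ^ᴺ (j ℕ.* L)) · X i
  vertex ⟨ j , i , true ⟩ = (α ^ᴺ (j ℕ.* L)) · Y i

  dim-αX : ∀ j i → i < t → HasDim ((α ^ᴺ (j ℕ.* L)) · X i) k
  dim-αX j i i<t = scale-dim _ (^-nonzero α (j ℕ.* L) α≢0) (dim-X i i<t)

  dim-αY : ∀ j i → i < t → HasDim ((α ^ᴺ (j ℕ.* L)) · Y i) (suc k)
  dim-αY j i i<t = scale-dim _ (^-nonzero α (j ℕ.* L) α≢0) (dim-Y i i<t)

  vertex-middle : ∀ s → Valid s → MiddleVertex k (vertex s)
  vertex-middle ⟨ j , i , false ⟩ i<t = inj₁ (dim-αX j i i<t)
  vertex-middle ⟨ j , i , true ⟩ i<t = inj₂ (dim-αY j i i<t)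

  -- consecutive stops of the walk give adjacent vertices: scaling preserves inclusions,
  -- and at the end of a lap α^((j+1)L) X₁ = α^(jL) (α^L X₁) ⊆ α^(jL) Y_t
  vertex-adjacent : ∀ s → Valid s → Adjacent (vertex s) (vertex (next s))
  vertex-adjacent ⟨ j , i , false ⟩ i<t = inj₁ (·-mono _ (X⊆Y i i<t) , k , dim-αX j i i<t , dim-αY j i i<t)
  vertex-adjacent ⟨ j , i , true ⟩ i<t with suc i ℕ.≟ t
  ... | yes refl = inj₂ (next-lap , k , dim-αX (suc j) 0 (s≤s z≤n) , dim-αY j i i<t)
    where
    next-lap : ((α ^ᴺ (suc j ℕ.* L)) · X 0) ⊆ ((α ^ᴺ (j ℕ.* L)) · Y t′)
    next-lap y h = ·-mono _ α^L·X₀⊆Y y (proj₂ (·-^ (j ℕ.* L) L (X 0)) y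
      (subst (λ z → ((α ^ᴺ z) · X 0) y) (ℕP.+-comm L (j ℕ.* L)) h))
  ... | no ≢t = inj₂ (·-mono _ (X⊆Y-previous i (ℕP.≤∧≢⇒< i<t ≢t)) , k ,
                     dim-αX j (suc i) (ℕP.≤∧≢⇒< i<t ≢t) , dim-αY j i i<t)

  -- after N laps the walk closes up: X₁ = α^(NL) X₁ = α^((N-1)L) α^L X₁ ⊆ α^((N-1)L) Y_t
  closing-adjacent : ∀ N′ → N ≡ suc N′ → Adjacent (vertex ⟨ N′ , t′ , true ⟩) (vertex ⟨ 0 , 0 , false ⟩)
  closing-adjacent N′ N≡ = inj₂ (X₀⊆ , k , dim-αX 0 0 (s≤s z≤n) , dim-αY N′ t′ (ℕP.n<1+n t′))
    where
    X₀⊆ : ((α ^ᴺ 0) · X 0) ⊆ ((α ^ᴺ (N′ ℕ.* L)) · Y t′)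
    X₀⊆ y h = ·-mono _ α^L·X₀⊆Y y (proj₂ (·-^ (N′ ℕ.* L) L (X 0)) y
      (subst (λ z → ((α ^ᴺ z) · X 0) y) (trans (cong (ℕ._* L) N≡) (ℕP.+-comm L (N′ ℕ.* L)))
        (scalar-absorb (dim-X 0 (s≤s z≤n)) L y (proj₁ (·-1 (X 0)) y h))))

  -- a subspace of dimension k or k+1 is not fixed by α^((j'-j)L) for 0 < j' - j < N,
  -- since N would have to divide (j'-j)·L, and L is coprime to N
  laps-distinct : ∀ {A d} → HasDim A d → d ≡ k ⊎ d ≡ suc k → ∀ {j j′} → j < j′ → j′ < N →
    ¬ ((α ^ᴺ (j ℕ.* L)) · A) ≐ ((α ^ᴺ (j′ ℕ.* L)) · A)
  laps-distinct {A} hd d∈ {j} {j′} j<j′ j′<N (_ , back) =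
    ℕP.<⇒≱ (ℕP.≤-<-trans (ℕP.m∸n≤m j′ j) j′<N) (∣⇒≤ ⦃ ℕ.>-nonZero (ℕP.m<n⇒0<n∸m j<j′) ⦄ N∣δ)
    where
    δ = j′ ∸ j
    j′L≡ : j′ ℕ.* L ≡ j ℕ.* L ℕ.+ δ ℕ.* L
    j′L≡ = trans (cong (ℕ._* L) (sym (ℕP.m+[n∸m]≡n (ℕP.<⇒≤ j<j′)))) (ℕP.*-distribʳ-+ L j δ)
    δL-stable : Stable A (δ ℕ.* L)
    δL-stable = translate-stable (j ℕ.* L) (δ ℕ.* L) (subst (λ z → ((α ^ᴺ z) · A) ⊆ ((α ^ᴺ (j ℕ.* L)) · A)) j′L≡ back)
    N∣δ : N ∣ δ
    N∣δ = ν-cancel ℓ ℓ-coprime-N δ (stabiliser hd d∈ δL-stable)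

  indices-distinct : ∀ {Z : ℕ → Sub} → (∀ i j → i < t → j < t → ¬ i ≡ j → ¬ Erel α (Z i) (Z j)) →
    ∀ {j j′ i i′} → i < t → i′ < t → ¬ i ≡ i′ → ¬ ((α ^ᴺ (j ℕ.* L)) · Z i) ≐ ((α ^ᴺ (j′ ℕ.* L)) · Z i′)
  indices-distinct {Z} inequiv {j} {j′} {i} {i′} i<t i′<t i≢i′ h =
    inequiv i i′ i<t i′<t i≢i′ (ℤ.+ ((Q₁ ∸ 1) ℕ.* (j′ ℕ.* L) ℕ.+ j ℕ.* L) , rescale (j ℕ.* L) (j′ ℕ.* L) (Z i) (Z i′) h)
    where import Data.Integer as ℤ

  vertex-distinct : ∀ s s′ → Valid s → Valid s′ → Stop.lap s < N → Stop.lap s′ < N → ¬ s ≡ s′ →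
    ¬ vertex s ≐ vertex s′
  vertex-distinct ⟨ j , i , false ⟩ ⟨ j′ , i′ , true ⟩ v v′ _ _ _ =
    dim-unique (s≤s (s≤s z≤n)) (dim-αX j i v) (dim-αY j′ i′ v′)
  vertex-distinct ⟨ j , i , true ⟩ ⟨ j′ , i′ , false ⟩ v v′ _ _ _ =
    dim-unique (s≤s (s≤s z≤n)) (dim-αX j′ i′ v′) (dim-αY j i v) ∘ ≐-sym
  vertex-distinct ⟨ j , i , false ⟩ ⟨ j′ , i′ , false ⟩ v v′ j<N j′<N ≢ with i ℕ.≟ i′
  ... | no i≢i′ = indices-distinct (λ a b p r ne → proj₁ (inequivalent a b p r ne)) {j} {j′} v v′ i≢i′
  ... | yes refl with ℕP.<-cmp j j′
  ...   | tri< lt _ _ = laps-distinct (dim-X i v) (inj₁ refl) lt j′<N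
  ...   | tri≈ _ refl _ = ⊥-elim (≢ refl)
  ...   | tri> _ _ gt = laps-distinct (dim-X i v) (inj₁ refl) gt j<N ∘ ≐-sym
  vertex-distinct ⟨ j , i , true ⟩ ⟨ j′ , i′ , true ⟩ v v′ j<N j′<N ≢ with i ℕ.≟ i′
  ... | no i≢i′ = indices-distinct (λ a b p r ne → proj₂ (inequivalent a b p r ne)) {j} {j′} v v′ i≢i′
  ... | yes refl with ℕP.<-cmp j j′
  ...   | tri< lt _ _ = laps-distinct (dim-Y i v) (inj₂ refl) lt j′<N
  ...   | tri≈ _ refl _ = ⊥-elim (≢ refl)
  ...   | tri> _ _ gt = laps-distinct (dim-Y i v) (inj₂ refl) gt j<N ∘ ≐-sym

  cycle : HasMiddleCycle k (2 ℕ.* t ℕ.* N)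
  cycle = vertex ∘ stop , length≥3 , (λ p _ → vertex-middle (stop p) (stop-valid p)) , distinct ,
          (λ p _ → vertex-adjacent (stop p) (stop-valid p)) , closes
    where
    length≥3 : 3 ≤ 2 ℕ.* t ℕ.* N
    length≥3 = ℕP.≤-trans (s≤s (s≤s (s≤s z≤n))) (ℕP.*-mono-≤ {2} {2 ℕ.* t} {2} {N} (ℕP.*-monoʳ-≤ 2 (s≤s z≤n)) N≥2)
    lap-bound : ∀ p → p < 2 ℕ.* t ℕ.* N → Stop.lap (stop p) < N
    lap-bound p p< = lap< N (stop p) (subst (_< N ℕ.* (2 ℕ.* t)) (sym (rank-stop p)) (subst (p <_) (ℕP.*-comm (2 ℕ.* t) N) p<))
    distinct : ∀ p p′ → p < p′ → p′ < 2 ℕ.* t ℕ.* N → ¬ vertex (stop p) ≐ vertex (stop p′)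
    distinct p p′ p<p′ p′< = vertex-distinct (stop p) (stop p′) (stop-valid p) (stop-valid p′)
      (lap-bound p (ℕP.<-trans p<p′ p′<)) (lap-bound p′ p′<)
      (λ e → ℕP.<⇒≢ p<p′ (trans (sym (rank-stop p)) (trans (cong rank e) (rank-stop p′))))
    N′ = ℕ.pred N
    N≡ : N ≡ suc N′
    N≡ = sym (ℕP.suc-pred N ⦃ ℕ.>-nonZero N>0 ⦄)
    closes : Adjacent (vertex (stop (2 ℕ.* t ℕ.* N ∸ 1))) (vertex (stop 0))
    closes = subst (λ s → Adjacent (vertex s) (vertex (stop 0)))
               (sym (trans (cong (λ z → stop (2 ℕ.* t ℕ.* z ∸ 1)) N≡) (last-stop N′)))
               (closing-adjacent N′ N≡)

open import Data.Nat using (ℕ; suc; _≤_; _<_; _∸_; _*_; _+_; _^_)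
open import Data.Nat.GCD using (gcd)
open import Data.Integer using (ℤ; ∣_∣)
open import Data.Product using (Σ; _×_)
open import Relation.Nullary using (¬_)
open import Relation.Binary.PropositionalEquality using (_≡_)
open import Data.Nat using (s≤s; z≤n)
open import Data.Product using (_,_)
open import Relation.Binary.PropositionalEquality using (subst; sym)

theorem1 : (q k : ℕ) → IsPrimePower q → 1 ≤ k →
    (Fq K : Field) → HasSize Fq q → HasSize K (q ^ (2 * k + 1)) →
    (E : Embedding Fq K) → (α : Field.Carrier K) → Primitive K α →
    (t : ℕ) → 1 ≤ t → (X Y : ℕ → VectorSpace.Sub E) →
    (∀ i → i < t → VectorSpace.HasDim E (X i) k) →
    (∀ i → i < t → VectorSpace.HasDim E (Y i) (suc k)) →
    (∀ i j → i < t → j < t → ¬ (i ≡ j) →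
      ¬ VectorSpace.Erel E α (X i) (X j) × ¬ VectorSpace.Erel E α (Y i) (Y j)) →
    (∀ i → i < t → VectorSpace._⊆_ E (X i) (Y i)) →
    (∀ i → suc i < t → VectorSpace._⊆_ E (X (suc i)) (Y i)) →
    (Σ ℤ λ ℓ → VectorSpace._⊆_ E (VectorSpace._·_ E (Field._^ᶻ_ K α ℓ) (X 0)) (Y (t ∸ 1))
              × gcd ∣ ℓ ∣ (gauss q (2 * k + 1)) ≡ 1) →
    VectorSpace.HasMiddleCycle E k (2 * t * gauss q (2 * k + 1))
-- q ≥ 2 because Fq has the distinct elements 0 and 1, and t ≥ 1; then Cycle applies
theorem1 q k _ k≥1 Fq K sizeQ sizeK E α prim (suc t′) (s≤s z≤n) X Y dim-X dim-Y inequivalent X⊆Y X⊆Y-previous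
         (ℓ , closing , coprime) with FieldFacts.Finite.two≤size Fq q sizeQ
... | s≤s (s≤s {n = q₂} z≤n) =
  subst (λ N → VectorSpace.HasMiddleCycle E k (2 * suc t′ * N)) (sym (NatFacts.gauss-geometric q₂ (2 * k + 1)))
    (Cycle.cycle q₂ k k≥1 sizeQ sizeK E α prim t′ X Y dim-X dim-Y inequivalent X⊆Y X⊆Y-previous ℓ closing coprime)
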